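{- For every arc $\alpha\in\mathcal A_n$, every face of the shard polytope $\mathrm{SP}(\alpha)$ is affinely isomorphic to a Cartesian product of shard polytopes (of arcs, possibly on a different number of points).
   Context: $]a,b[=\{a+1,\dots,b-1\}$, $(\mathbf e_i)$ is the standard basis of $\mathbb R^n$. An arc on $[m]$ is a quadruple $\alpha=(a,b,A,B)$ with $1\le a<b\le m$ and $A\sqcup B=]a,b[$ (a partition); $\mathcal A_m$ is the set of arcs on $[m]$. An $\alpha$-alternating matching is a (possibly empty) set $M=\{a_1<b_1<\dots<a_k<b_k\}$ with $a\le a_1$, $b_k\le b$, $a_i\in\{a\}\cup A$ and $b_i\in B\cup\{b\}$; its characteristic vector is $\chi(M)=\sum_{i}(\mathbf e_{a_i}-\mathbf e_{b_i})$. The shard polytope is $\mathrm{SP}(\alpha)=\mathrm{conv}\{\chi(M): M\ \alpha\text{ -alternating matching}\}\subset\mathbb R^m$.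
   Formalization: Stated over ℚ rather than ℝ: points of shard polytopes, faces and products have rational coordinates, and the linear functionals cutting out faces and the affine isomorphisms have rational coefficients. -}

module Defs where

open import Data.Nat using (ℕ; zero; suc)
import Data.Nat as ℕ
open import Data.Fin using (Fin; _<_; _≟_)
open import Data.Bool using (Bool; true; false; if_then_else_)
open import Data.Product using (Σ; _×_; _,_; proj₁; proj₂; ∃)
open import Data.Sum using (_⊎_)
open import Data.Unit using (⊤)
open import Data.List using (List; []; _∷_)
open import Data.List.Relation.Unary.All using (All)
open import Data.Rational using (ℚ; 0ℚ; 1ℚ; _+_; _*_; _-_; _≤_)
open import Relation.Nullary.Decidable using (⌊_⌋)
open import Relation.Binary.PropositionalEquality using (_≡_)
open import Data.Vec.Functional using (take; drop)

-- Points of ℚ^m, coordinates indexed by Fin m (index i stands for i+1 ∈ [m]).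
Point : ℕ → Set
Point m = Fin m → ℚ

_≈ₚ_ : ∀ {m} → Point m → Point m → Set
x ≈ₚ y = ∀ i → x i ≡ y i

sumFin : ∀ {m} → (Fin m → ℚ) → ℚ
sumFin {zero}  f = 0ℚ
sumFin {suc m} f = f Fin.zero + sumFin {m} (λ i → f (Fin.suc i))

dot : ∀ {m} → Point m → Point m → ℚ
dot c x = sumFin (λ i → c i * x i)

e : ∀ {m} → Fin m → Point m
e j i = if ⌊ i ≟ j ⌋ then 1ℚ else 0ℚ

-- An arc (a, b, A, B) on [m]: a < b, and the interior ]a,b[ is split into
-- A = {i ∈ ]a,b[ | inA i = true} and B = {i ∈ ]a,b[ | inA i = false}.
-- (Values of inA outside ]a,b[ are irrelevant.)
record Arc (m : ℕ) : Set where
  constructor arc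
  field
    a   : Fin m
    b   : Fin m
    a<b : a < b
    inA : Fin m → Bool
open Arc public

Interior : ∀ {m} → Arc m → Fin m → Set
Interior α i = (a α < i) × (i < b α)

IsLeft : ∀ {m} → Arc m → Fin m → Set
IsLeft α i = (i ≡ a α) ⊎ (Interior α i × inA α i ≡ true)

IsRight : ∀ {m} → Arc m → Fin m → Set
IsRight α i = (i ≡ b α) ⊎ (Interior α i × inA α i ≡ false)

-- A matching {a₁ < b₁ < … < a_k < b_k} is the list of pairs (aᵢ , bᵢ).
Matching : ℕ → Set
Matching m = List (Fin m × Fin m)

GoodPair : ∀ {m} → Arc m → Fin m × Fin m → Set
GoodPair α (x , y) = IsLeft α x × IsRight α y × x < y

Chain : ∀ {m} → Matching m → Set
Chain []                          = ⊤
Chain (_ ∷ [])                    = ⊤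
Chain ((_ , y) ∷ (x' , y') ∷ ps)  = (y < x') × Chain ((x' , y') ∷ ps)

-- α-alternating matching (a ≤ a₁ and b_k ≤ b follow from IsLeft / IsRight)
Alternating : ∀ {m} → Arc m → Matching m → Set
Alternating α M = All (GoodPair α) M × Chain M

χ : ∀ {m} → Matching m → Point m
χ []             i = 0ℚ
χ ((x , y) ∷ ps) i = (e x i - e y i) + χ ps i

AltMatching : ∀ {m} → Arc m → Set
AltMatching {m} α = Σ (Matching m) (Alternating α)

sumList : ∀ {A : Set} → (A → ℚ) → List A → ℚ
sumList f []       = 0ℚ
sumList f (x ∷ xs) = f x + sumList f xs

InSP : ∀ {m} → (α : Arc m) → Point m → Set
InSP α x =
  ∃ λ (comb : List (ℚ × AltMatching α)) →
    All (λ p → 0ℚ ≤ proj₁ p) comb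
    × sumList proj₁ comb ≡ 1ℚ
    × (∀ i → x i ≡ sumList (λ p → proj₁ p * χ (proj₁ (proj₂ p)) i) comb)

-- The (nonempty) face of SP(α) maximizing the linear functional c.
InFace : ∀ {m} → (α : Arc m) → Point m → Point m → Set
InFace α c x = InSP α x × (∀ y → InSP α y → dot c y ≤ dot c x)

ArcList : Set
ArcList = List (Σ ℕ Arc)

dimL : ArcList → ℕ
dimL []             = 0
dimL ((m , _) ∷ ps) = m ℕ.+ dimL ps

InProd : (ps : ArcList) → Point (dimL ps) → Set
InProd []             z = ⊤
InProd ((m , α) ∷ ps) z = InSP α (take m z) × InProd ps (drop m z)

record Affine (m k : ℕ) : Set where
  constructor affine
  field
    L : Fin k → Fin m → ℚ
    t : Point k

applyAff : ∀ {m k} → Affine m k → Point m → Point k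
applyAff f x j = dot (Affine.L f j) x + Affine.t f j

AffinelyIsomorphic : ∀ {m k} → (Point m → Set) → (Point k → Set) → Set
AffinelyIsomorphic {m} {k} P Q =
  ∃ λ (f : Affine m k) →
    (∀ x → P x → Q (applyAff f x))
    × (∀ x y → P x → P y → applyAff f x ≈ₚ applyAff f y → x ≈ₚ y)
    × (∀ z → Q z → ∃ λ x → P x × applyAff f x ≈ₚ z)

-- Encode an α-alternating matching M by the 0/1 vector y with y i = 1 iff aⱼ ≤ i < bⱼ for some j.
-- Then χ(M) is the discrete derivative δ y of y, and being α-alternating becomes a condition on
-- consecutive bits: y vanishes outside [a, b[, and runs of ones start only at a or in A and end only
-- in B or at b.  The face of SP(α) maximising c is the hull of the δ y with y feasible of maximal
-- score.  Splicing two optimal vectors at a position where they agree gives two feasible vectors with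
-- the same total score, so both are optimal.  Hence the optimal vectors are exactly those satisfying
-- local constraints: some positions are fixed, and every other position is free, a copy of its
-- predecessor, or related to it by the interior rule.  A maximal stretch of unfixed positions then
-- ranges over the feasible vectors of a chain arc whose interior points are the related positions,
-- and selecting coordinates between prefix sums and blockwise differences maps the face affinely and
-- bijectively onto the product of the shard polytopes of these chain arcs.

module Submission where

open import Defs
open import Data.Nat using (ℕ)
open import Data.Product using (∃)
open import Data.Nat as ℕ using (zero; suc; _<?_)
import Data.Nat.Properties as ℕP
open import Data.Fin as F using (Fin; zero; suc; toℕ; inject₁; _↑ˡ_; _↑ʳ_; splitAt)
import Data.Fin.Properties as FinP
open import Data.Bool using (Bool; true; false; if_then_else_; not; _∧_; _∨_)
import Data.Bool.Properties as BoolP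
open import Data.Product using (Σ; _×_; _,_; proj₁; proj₂)
open import Data.Sum using (_⊎_; inj₁; inj₂)
open import Data.Unit using (⊤; tt)
open import Data.Empty using (⊥; ⊥-elim)
open import Data.List using (List; []; _∷_; map; concatMap; length) renaming (_++_ to _++ᴸ_)
open import Data.List.Relation.Unary.All as All using (All; []; _∷_)
import Data.List.Relation.Unary.All.Properties as AllP
open import Data.List.Relation.Unary.Any as Any using (Any; here)
import Data.List.Relation.Unary.Any.Properties as AnyP
open import Data.Maybe as Maybe using (Maybe; just; nothing)
open import Data.Rational as ℚ using (ℚ; 0ℚ; 1ℚ; _+_; _*_; _-_; _≤_; -_)
import Data.Rational.Properties as ℚP
open import Data.Rational.Solver using (module +-*-Solver)
open +-*-Solver
open import Function.Bundles using (_⇔_; mk⇔; Equivalence)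
import Function.Properties.Equivalence as ⇔
open import Data.Product.Function.NonDependent.Propositional using (_×-⇔_)
open import Relation.Nullary using (yes; no; ¬_; Dec)
open import Relation.Nullary.Decidable using (toWitness; toWitnessFalse; ¬?; decidable-stable)
open import Relation.Binary.PropositionalEquality
open import Relation.Binary.Definitions using (tri<; tri≈; tri>)
open import Data.Vec.Functional using (tail; take; drop; _++_) renaming (_∷_ to _∷ᵛ_)
open import Data.Vec.Functional.Properties using (lookup-++ˡ; lookup-++ʳ)

open Equivalence using (to; from)

-- Finite sums

sumFin-cong : ∀ {m} {f g : Fin m → ℚ} → (∀ i → f i ≡ g i) → sumFin f ≡ sumFin g
sumFin-cong {zero} h = refl
sumFin-cong {suc m} h = cong₂ _+_ (h zero) (sumFin-cong (λ i → h (suc i)))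

sumFin-0 : ∀ {m} → sumFin {m} (λ _ → 0ℚ) ≡ 0ℚ
sumFin-0 {zero} = refl
sumFin-0 {suc m} rewrite sumFin-0 {m} = refl

sumFin-+ : ∀ {m} (f g : Fin m → ℚ) → sumFin (λ i → f i + g i) ≡ sumFin f + sumFin g
sumFin-+ {zero} f g = refl
sumFin-+ {suc m} f g rewrite sumFin-+ (λ i → f (suc i)) (λ i → g (suc i)) =
  solve 4 (λ a b c d → (a :+ b) :+ (c :+ d) := (a :+ c) :+ (b :+ d)) refl
    (f zero) (g zero) (sumFin (λ i → f (suc i))) (sumFin (λ i → g (suc i)))

sumFin-* : ∀ {m} (q : ℚ) (f : Fin m → ℚ) → sumFin (λ i → q * f i) ≡ q * sumFin f
sumFin-* {zero} q f = sym (ℚP.*-zeroʳ q)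
sumFin-* {suc m} q f rewrite sumFin-* q (λ i → f (suc i)) = sym (ℚP.*-distribˡ-+ q (f zero) _)

sumFin-neg : ∀ {m} (f : Fin m → ℚ) → sumFin (λ i → - f i) ≡ - sumFin f
sumFin-neg {zero} f = refl
sumFin-neg {suc m} f rewrite sumFin-neg (λ i → f (suc i)) =
  sym (ℚP.neg-distrib-+ (f zero) (sumFin (λ i → f (suc i))))

sumFin-swap : ∀ {m k} (G : Fin m → Fin k → ℚ) →
  sumFin (λ i → sumFin (G i)) ≡ sumFin (λ j → sumFin (λ i → G i j))
sumFin-swap {zero} {k} G = sym (sumFin-0 {k})
sumFin-swap {suc m} G = begin
    sumFin (G zero) + sumFin (λ i → sumFin (G (suc i)))
  ≡⟨ cong (sumFin (G zero) +_) (sumFin-swap (λ i → G (suc i))) ⟩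
    sumFin (G zero) + sumFin (λ j → sumFin (λ i → G (suc i) j))
  ≡⟨ sym (sumFin-+ (G zero) _) ⟩
    sumFin (λ j → sumFin (λ i → G i j)) ∎
  where open ≡-Reasoning

e-same : ∀ {m} (j : Fin m) → e j j ≡ 1ℚ
e-same j with j F.≟ j
... | yes _ = refl
... | no j≢j = ⊥-elim (j≢j refl)

e-≢ : ∀ {m} (i j : Fin m) → i ≢ j → e j i ≡ 0ℚ
e-≢ i j i≢j with i F.≟ j
... | yes i≡j = ⊥-elim (i≢j i≡j)
... | no _ = refl

e-suc : ∀ {m} (i j : Fin m) → e (suc j) (suc i) ≡ e j i
e-suc i j with i F.≟ j
... | yes refl = refl
... | no _ = refl

sumFin-*e : ∀ {m} (f : Fin m → ℚ) (j : Fin m) → sumFin (λ i → f i * e j i) ≡ f j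
sumFin-*e {suc m} f zero = begin
    f zero * 1ℚ + sumFin (λ i → f (suc i) * e zero (suc i))
  ≡⟨ cong₂ _+_ (ℚP.*-identityʳ (f zero))
       (trans (sumFin-cong (λ i → ℚP.*-zeroʳ (f (suc i)))) (sumFin-0 {m})) ⟩
    f zero + 0ℚ
  ≡⟨ ℚP.+-identityʳ _ ⟩
    f zero ∎
  where open ≡-Reasoning
sumFin-*e {suc m} f (suc j) = begin
    f zero * 0ℚ + sumFin (λ i → f (suc i) * e (suc j) (suc i))
  ≡⟨ cong₂ _+_ (ℚP.*-zeroʳ (f zero)) (sumFin-cong (λ i → cong (f (suc i) *_) (e-suc i j))) ⟩
    0ℚ + sumFin (λ i → f (suc i) * e j i)
  ≡⟨ ℚP.+-identityˡ _ ⟩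
    sumFin (λ i → f (suc i) * e j i)
  ≡⟨ sumFin-*e (λ i → f (suc i)) j ⟩
    f (suc j) ∎
  where open ≡-Reasoning

dot-cong : ∀ {m} (l : Point m) {x x' : Point m} → x ≈ₚ x' → dot l x ≡ dot l x'
dot-cong l x≈x' = sumFin-cong (λ i → cong (l i *_) (x≈x' i))

dot-e : ∀ {m} (j : Fin m) (x : Point m) → dot (e j) x ≡ x j
dot-e j x = trans (sumFin-cong (λ i → ℚP.*-comm (e j i) (x i))) (sumFin-*e x j)

dot-+ˡ : ∀ {m} (l l' x : Point m) → dot (λ i → l i + l' i) x ≡ dot l x + dot l' x
dot-+ˡ l l' x =
  trans (sumFin-cong (λ i → ℚP.*-distribʳ-+ (x i) (l i) (l' i))) (sumFin-+ (λ i → l i * x i) (λ i → l' i * x i))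

dot-+ʳ : ∀ {m} (l x x' : Point m) → dot l (λ i → x i + x' i) ≡ dot l x + dot l x'
dot-+ʳ l x x' =
  trans (sumFin-cong (λ i → ℚP.*-distribˡ-+ (l i) (x i) (x' i))) (sumFin-+ (λ i → l i * x i) (λ i → l i * x' i))

dot-negˡ : ∀ {m} (l x : Point m) → dot (λ i → - l i) x ≡ - dot l x
dot-negˡ l x = trans (sumFin-cong (λ i → sym (ℚP.neg-distribˡ-* (l i) (x i)))) (sumFin-neg (λ i → l i * x i))

sumList-cong : ∀ {A : Set} {f g : A → ℚ} (xs : List A) → (∀ a → f a ≡ g a) → sumList f xs ≡ sumList g xs
sumList-cong [] h = refl
sumList-cong (x ∷ xs) h = cong₂ _+_ (h x) (sumList-cong xs h)

sumList-0 : ∀ {A : Set} (xs : List A) → sumList (λ _ → 0ℚ) xs ≡ 0ℚ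
sumList-0 [] = refl
sumList-0 (x ∷ xs) rewrite sumList-0 xs = refl

sumList-+ : ∀ {A : Set} (f g : A → ℚ) (xs : List A) → sumList (λ a → f a + g a) xs ≡ sumList f xs + sumList g xs
sumList-+ f g [] = refl
sumList-+ f g (x ∷ xs) rewrite sumList-+ f g xs =
  solve 4 (λ a b c d → (a :+ b) :+ (c :+ d) := (a :+ c) :+ (b :+ d)) refl (f x) (g x) (sumList f xs) (sumList g xs)

sumList-neg : ∀ {A : Set} (f : A → ℚ) (xs : List A) → sumList (λ a → - f a) xs ≡ - sumList f xs
sumList-neg f [] = refl
sumList-neg f (x ∷ xs) rewrite sumList-neg f xs = sym (ℚP.neg-distrib-+ (f x) (sumList f xs))

sumList-* : ∀ {A : Set} (q : ℚ) (f : A → ℚ) (xs : List A) → sumList (λ a → q * f a) xs ≡ q * sumList f xs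
sumList-* q f [] = sym (ℚP.*-zeroʳ q)
sumList-* q f (x ∷ xs) rewrite sumList-* q f xs = sym (ℚP.*-distribˡ-+ q (f x) _)

sumList-*ʳ : ∀ {A : Set} (q : ℚ) (f : A → ℚ) (xs : List A) → sumList (λ a → f a * q) xs ≡ sumList f xs * q
sumList-*ʳ q f xs =
  trans (sumList-cong xs (λ a → ℚP.*-comm (f a) q)) (trans (sumList-* q f xs) (ℚP.*-comm q _))

sumList-sumFin : ∀ {A : Set} {m} (G : A → Fin m → ℚ) (xs : List A) →
  sumList (λ a → sumFin (G a)) xs ≡ sumFin (λ i → sumList (λ a → G a i) xs)
sumList-sumFin {m = m} G [] = sym (sumFin-0 {m})
sumList-sumFin G (x ∷ xs) rewrite sumList-sumFin G xs = sym (sumFin-+ (G x) _)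

sumList-map : ∀ {A B : Set} (f : B → ℚ) (g : A → B) (xs : List A) →
  sumList f (map g xs) ≡ sumList (λ a → f (g a)) xs
sumList-map f g [] = refl
sumList-map f g (x ∷ xs) = cong (f (g x) +_) (sumList-map f g xs)

sumList-++ : ∀ {A : Set} (f : A → ℚ) (xs ys : List A) → sumList f (xs ++ᴸ ys) ≡ sumList f xs + sumList f ys
sumList-++ f [] ys = sym (ℚP.+-identityˡ _)
sumList-++ f (x ∷ xs) ys rewrite sumList-++ f xs ys = sym (ℚP.+-assoc (f x) _ _)

sumList-concatMap : ∀ {A B : Set} (f : B → ℚ) (g : A → List B) (xs : List A) →
  sumList f (concatMap g xs) ≡ sumList (λ a → sumList f (g a)) xs
sumList-concatMap f g [] = refl
sumList-concatMap f g (x ∷ xs) =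
  trans (sumList-++ f (g x) (concatMap g xs)) (cong (sumList f (g x) +_) (sumList-concatMap f g xs))

sumList-mono : ∀ {A : Set} (f g : A → ℚ) (xs : List A) → All (λ x → f x ≤ g x) xs → sumList f xs ≤ sumList g xs
sumList-mono f g [] [] = ℚP.≤-refl
sumList-mono f g (x ∷ xs) (h ∷ hs) = ℚP.+-mono-≤ h (sumList-mono f g xs hs)

0≤1 : 0ℚ ≤ 1ℚ
0≤1 = toWitness {a? = 0ℚ ℚP.≤? 1ℚ} tt

0≤* : ∀ {p q : ℚ} → 0ℚ ≤ p → 0ℚ ≤ q → 0ℚ ≤ p * q
0≤* {p} {q} 0≤p 0≤q =
  ℚP.nonNegative⁻¹ (p * q) {{ℚP.nonNeg*nonNeg⇒nonNeg p {{ℚ.nonNegative 0≤p}} q {{ℚ.nonNegative 0≤q}}}}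

*-monoˡ-≤ : ∀ {l p q : ℚ} → 0ℚ ≤ l → p ≤ q → l * p ≤ l * q
*-monoˡ-≤ {l} 0≤l = ℚP.*-monoˡ-≤-nonNeg l {{ℚ.nonNegative 0≤l}}

p≤q⇒0≤q-p : ∀ {p q : ℚ} → p ≤ q → 0ℚ ≤ q - p
p≤q⇒0≤q-p {p} {q} p≤q = subst (_≤ q - p) (ℚP.+-inverseʳ p) (ℚP.+-monoˡ-≤ (- p) p≤q)

p≤q⇒p-q≤0 : ∀ {p q : ℚ} → p ≤ q → p - q ≤ 0ℚ
p≤q⇒p-q≤0 {p} {q} p≤q = subst (p - q ≤_) (ℚP.+-inverseʳ q) (ℚP.+-monoˡ-≤ (- q) p≤q)

*≡0⇒≡0 : ∀ (p q : ℚ) → p * q ≡ 0ℚ → q ≢ 0ℚ → p ≡ 0ℚ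
*≡0⇒≡0 p q pq≡0 q≢0 = begin
    p                ≡⟨ sym (ℚP.*-identityʳ p) ⟩
    p * 1ℚ           ≡⟨ cong (p *_) (sym (ℚP.*-inverseʳ q {{nz}})) ⟩
    p * (q * q⁻¹)    ≡⟨ sym (ℚP.*-assoc p q q⁻¹) ⟩
    (p * q) * q⁻¹    ≡⟨ cong (_* q⁻¹) pq≡0 ⟩
    0ℚ * q⁻¹         ≡⟨ ℚP.*-zeroˡ q⁻¹ ⟩
    0ℚ               ∎
  where
  open ≡-Reasoning
  nz = ℚ.≢-nonZero q≢0
  q⁻¹ : ℚ
  q⁻¹ = (ℚ.1/ q) {{nz}}

sumList-nonNeg-≤0 : ∀ {A : Set} (f : A → ℚ) (xs : List A) → All (λ x → 0ℚ ≤ f x) xs →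
  sumList f xs ≤ 0ℚ → All (λ x → f x ≡ 0ℚ) xs
sumList-nonNeg-≤0 f [] [] _ = []
sumList-nonNeg-≤0 f (x ∷ xs) (0≤fx ∷ hs) sum≤0 = ℚP.≤-antisym fx≤0 0≤fx ∷ sumList-nonNeg-≤0 f xs hs rest≤0
  where
  0≤rest : 0ℚ ≤ sumList f xs
  0≤rest = subst (_≤ sumList f xs) (sumList-0 xs) (sumList-mono (λ _ → 0ℚ) f xs hs)
  fx≤0 : f x ≤ 0ℚ
  fx≤0 = ℚP.≤-trans (subst (_≤ f x + sumList f xs) (ℚP.+-identityʳ (f x)) (ℚP.+-monoʳ-≤ (f x) 0≤rest)) sum≤0
  rest≤0 : sumList f xs ≤ 0ℚ
  rest≤0 = ℚP.≤-trans (subst (_≤ f x + sumList f xs) (ℚP.+-identityˡ _) (ℚP.+-monoˡ-≤ (sumList f xs) 0≤fx)) sum≤0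

-- Affine maps and convex hulls

IsAffine : ∀ {m} → (Point m → ℚ) → Set
IsAffine {m} φ = Σ (Point m) λ l → Σ ℚ λ t → ∀ x → φ x ≡ dot l x + t

IsAffineMap : ∀ {m k} → (Point m → Point k) → Set
IsAffineMap F = ∀ j → IsAffine (λ x → F x j)

toAffine : ∀ {m k} {F : Point m → Point k} → IsAffineMap F → Affine m k
toAffine F-affine = affine (λ j → proj₁ (F-affine j)) (λ j → proj₁ (proj₂ (F-affine j)))

applyAff-toAffine : ∀ {m k} {F : Point m → Point k} (F-affine : IsAffineMap F) x →
  applyAff (toAffine F-affine) x ≈ₚ F x
applyAff-toAffine F-affine x j = sym (proj₂ (proj₂ (F-affine j)) x)

affine-cong : ∀ {m} {φ : Point m → ℚ} → IsAffine φ → ∀ {x y} → x ≈ₚ y → φ x ≡ φ y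
affine-cong (l , t , φ≡) {x} {y} x≈y rewrite φ≡ x | φ≡ y = cong (_+ t) (dot-cong l x≈y)

affineMap-cong : ∀ {m k} {F : Point m → Point k} → IsAffineMap F → ∀ {x y} → x ≈ₚ y → F x ≈ₚ F y
affineMap-cong F-affine x≈y j = affine-cong (F-affine j) x≈y

affine-proj : ∀ {m} (i : Fin m) → IsAffine (λ x → x i)
affine-proj i = e i , 0ℚ , λ x → sym (trans (ℚP.+-identityʳ _) (dot-e i x))

affine-const : ∀ {m} (q : ℚ) → IsAffine {m} (λ _ → q)
affine-const {m} q = (λ _ → 0ℚ) , q , λ x →
  sym (trans (cong (_+ q) (trans (sumFin-cong (λ i → ℚP.*-zeroˡ (x i))) (sumFin-0 {m}))) (ℚP.+-identityˡ q))

affine-+ : ∀ {m} {φ ψ : Point m → ℚ} → IsAffine φ → IsAffine ψ → IsAffine (λ x → φ x + ψ x)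
affine-+ (l , t , φ≡) (l' , t' , ψ≡) = (λ i → l i + l' i) , t + t' , λ x →
  trans (cong₂ _+_ (φ≡ x) (ψ≡ x)) (trans
   (solve 4 (λ a b c d → (a :+ b) :+ (c :+ d) := (a :+ c) :+ (b :+ d)) refl (dot l x) t (dot l' x) t')
   (cong (_+ (t + t')) (sym (dot-+ˡ l l' x))))

affine-neg : ∀ {m} {φ : Point m → ℚ} → IsAffine φ → IsAffine (λ x → - φ x)
affine-neg (l , t , φ≡) = (λ i → - l i) , - t , λ x →
  trans (cong -_ (φ≡ x)) (trans (ℚP.neg-distrib-+ (dot l x) t) (cong (_+ - t) (sym (dot-negˡ l x))))

affine-- : ∀ {m} {φ ψ : Point m → ℚ} → IsAffine φ → IsAffine ψ → IsAffine (λ x → φ x - ψ x)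
affine-- φ-affine ψ-affine = affine-+ φ-affine (affine-neg ψ-affine)

dot-∘-linear : ∀ {m k} (l : Point k) (L : Fin k → Point m) (x : Point m) →
  sumFin (λ j → l j * dot (L j) x) ≡ dot (λ i → sumFin (λ j → l j * L j i)) x
dot-∘-linear {m} {k} l L x = begin
    sumFin (λ j → l j * sumFin (λ i → L j i * x i))
  ≡⟨ sumFin-cong (λ j → sym (sumFin-* (l j) (λ i → L j i * x i))) ⟩
    sumFin (λ j → sumFin (λ i → l j * (L j i * x i)))
  ≡⟨ sumFin-swap (λ j i → l j * (L j i * x i)) ⟩
    sumFin (λ i → sumFin (λ j → l j * (L j i * x i)))
  ≡⟨ sumFin-cong (λ i → trans (sumFin-cong (λ j → reassoc (l j) (L j i) (x i))) (sumFin-*ʳ (x i) (λ j → l j * L j i))) ⟩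
    sumFin (λ i → sumFin (λ j → l j * L j i) * x i) ∎
  where
  open ≡-Reasoning
  reassoc : ∀ a b c → a * (b * c) ≡ (a * b) * c
  reassoc a b c = sym (ℚP.*-assoc a b c)
  sumFin-*ʳ : ∀ (q : ℚ) (f : Fin k → ℚ) → sumFin (λ j → f j * q) ≡ sumFin f * q
  sumFin-*ʳ q f = trans (sumFin-cong (λ j → ℚP.*-comm (f j) q)) (trans (sumFin-* q f) (ℚP.*-comm q _))

affine-∘ : ∀ {m k} {φ : Point k → ℚ} {F : Point m → Point k} → IsAffine φ → IsAffineMap F →
  IsAffine (λ x → φ (F x))
affine-∘ {m} {k} {φ} {F} (l , t , φ≡) F-affine =
  (λ i → sumFin (λ j → l j * L j i)) , sumFin (λ j → l j * T j) + t , λ x → begin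
    φ (F x)
  ≡⟨ φ≡ (F x) ⟩
    sumFin (λ j → l j * F x j) + t
  ≡⟨ cong (_+ t) (sumFin-cong (λ j → cong (l j *_) (proj₂ (proj₂ (F-affine j)) x))) ⟩
    sumFin (λ j → l j * (dot (L j) x + T j)) + t
  ≡⟨ cong (_+ t) (trans (sumFin-cong (λ j → ℚP.*-distribˡ-+ (l j) _ _)) (sumFin-+ (λ j → l j * dot (L j) x) (λ j → l j * T j))) ⟩
    sumFin (λ j → l j * dot (L j) x) + sumFin (λ j → l j * T j) + t
  ≡⟨ cong (λ z → z + sumFin (λ j → l j * T j) + t) (dot-∘-linear l L x) ⟩
    dot (λ i → sumFin (λ j → l j * L j i)) x + sumFin (λ j → l j * T j) + t
  ≡⟨ ℚP.+-assoc (dot (λ i → sumFin (λ j → l j * L j i)) x) (sumFin (λ j → l j * T j)) t ⟩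
    dot (λ i → sumFin (λ j → l j * L j i)) x + (sumFin (λ j → l j * T j) + t) ∎
  where
  open ≡-Reasoning
  L : Fin k → Fin m → ℚ
  L j = proj₁ (F-affine j)
  T : Fin k → ℚ
  T j = proj₁ (proj₂ (F-affine j))

affineMap-∘ : ∀ {m k o} {G : Point k → Point o} {F : Point m → Point k} →
  IsAffineMap G → IsAffineMap F → IsAffineMap (λ x → G (F x))
affineMap-∘ G-affine F-affine j = affine-∘ (G-affine j) F-affine

affineMap-take : ∀ m {k} → IsAffineMap (take m {k})
affineMap-take m {k} j = affine-proj (j ↑ˡ k)

affineMap-drop : ∀ m {k} → IsAffineMap (drop m {k})
affineMap-drop m j = affine-proj (m ↑ʳ j)

affineMap-++ : ∀ {n m k} {F : Point n → Point m} {G : Point n → Point k} →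
  IsAffineMap F → IsAffineMap G → IsAffineMap (λ x → F x ++ G x)
affineMap-++ {m = m} F-affine G-affine j with splitAt m j
... | inj₁ j' = F-affine j'
... | inj₂ j' = G-affine j'

Combination : ℕ → Set
Combination m = List (ℚ × Point m)

combine : ∀ {m} → Combination m → Point m
combine cs i = sumList (λ p → proj₁ p * proj₂ p i) cs

weight : ∀ {m} → Combination m → ℚ
weight = sumList proj₁

Supported : ∀ {m} → (Point m → Set) → Combination m → Set
Supported V = All (λ p → (0ℚ ≤ proj₁ p) × V (proj₂ p))

ConvexHull : ∀ {m} → (Point m → Set) → Point m → Set
ConvexHull {m} V x = Σ (Combination m) λ cs → Supported V cs × weight cs ≡ 1ℚ × x ≈ₚ combine cs

mapPoints : ∀ {m k} → (Point m → Point k) → Combination m → Combination k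
mapPoints f = map (λ p → proj₁ p , f (proj₂ p))

weight-mapPoints : ∀ {m k} (f : Point m → Point k) (cs : Combination m) → weight (mapPoints f cs) ≡ weight cs
weight-mapPoints f cs = sumList-map proj₁ _ cs

singleton-hull : ∀ {m} {V : Point m → Set} {v : Point m} → V v → ConvexHull V v
singleton-hull {v = v} Vv = (1ℚ , v) ∷ [] , (0≤1 , Vv) ∷ [] , ℚP.+-identityʳ 1ℚ ,
  λ i → sym (trans (ℚP.+-identityʳ _) (ℚP.*-identityˡ _))

hull-mono : ∀ {m} {V V' : Point m → Set} → (∀ v → V v → V' v) → ∀ x → ConvexHull V x → ConvexHull V' x
hull-mono V⊆V' x (cs , supp , w , x≈) = cs , All.map (λ (0≤μ , Vv) → 0≤μ , V⊆V' _ Vv) supp , w , x≈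

dot-combine : ∀ {m} (l : Point m) (cs : Combination m) →
  dot l (combine cs) ≡ sumList (λ p → proj₁ p * dot l (proj₂ p)) cs
dot-combine l cs = begin
    sumFin (λ i → l i * sumList (λ p → proj₁ p * proj₂ p i) cs)
  ≡⟨ sumFin-cong (λ i → trans (sym (sumList-* (l i) _ cs)) (sumList-cong cs (λ p →
        solve 3 (λ a b c → a :* (b :* c) := b :* (a :* c)) refl (l i) (proj₁ p) (proj₂ p i)))) ⟩
    sumFin (λ i → sumList (λ p → proj₁ p * (l i * proj₂ p i)) cs)
  ≡⟨ sym (sumList-sumFin (λ p i → proj₁ p * (l i * proj₂ p i)) cs) ⟩
    sumList (λ p → sumFin (λ i → proj₁ p * (l i * proj₂ p i))) cs
  ≡⟨ sumList-cong cs (λ p → sumFin-* (proj₁ p) (λ i → l i * proj₂ p i)) ⟩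
    sumList (λ p → proj₁ p * dot l (proj₂ p)) cs ∎
  where open ≡-Reasoning

affine-combine : ∀ {m} {φ : Point m → ℚ} → IsAffine φ → (cs : Combination m) → weight cs ≡ 1ℚ →
  φ (combine cs) ≡ sumList (λ p → proj₁ p * φ (proj₂ p)) cs
affine-combine {φ = φ} (l , t , φ≡) cs w≡1 = begin
    φ (combine cs)
  ≡⟨ φ≡ _ ⟩
    dot l (combine cs) + t
  ≡⟨ cong₂ _+_ (dot-combine l cs) t≡ ⟩
    sumList (λ p → proj₁ p * dot l (proj₂ p)) cs + sumList (λ p → proj₁ p * t) cs
  ≡⟨ sym (sumList-+ _ _ cs) ⟩
    sumList (λ p → proj₁ p * dot l (proj₂ p) + proj₁ p * t) cs
  ≡⟨ sumList-cong cs (λ p → trans (sym (ℚP.*-distribˡ-+ (proj₁ p) _ _)) (cong (proj₁ p *_) (sym (φ≡ (proj₂ p))))) ⟩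
    sumList (λ p → proj₁ p * φ (proj₂ p)) cs ∎
  where
  open ≡-Reasoning
  t≡ : t ≡ sumList (λ p → proj₁ p * t) cs
  t≡ = trans (sym (ℚP.*-identityˡ t)) (trans (cong (_* t) (sym w≡1)) (sym (sumList-*ʳ t proj₁ cs)))

affineMap-combine : ∀ {m k} {F : Point m → Point k} → IsAffineMap F → (cs : Combination m) → weight cs ≡ 1ℚ →
  F (combine cs) ≈ₚ combine (mapPoints F cs)
affineMap-combine F-affine cs w≡1 j = trans (affine-combine (F-affine j) cs w≡1) (sym (sumList-map _ _ cs))

hull-image : ∀ {m k} {V : Point m → Set} {W : Point k → Set} {F : Point m → Point k} →
  IsAffineMap F → (∀ v → V v → W (F v)) → ∀ x → ConvexHull V x → ConvexHull W (F x)
hull-image {m} {V = V} {W} {F} F-affine F-maps x (cs , supp , w≡1 , x≈) =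
  mapPoints F cs , mapSupp cs supp , trans (weight-mapPoints F cs) w≡1 ,
  λ j → trans (affineMap-cong F-affine x≈ j) (affineMap-combine F-affine cs w≡1 j)
  where
  mapSupp : (cs : Combination m) → Supported V cs → Supported W (mapPoints F cs)
  mapSupp [] [] = []
  mapSupp (p ∷ cs) ((0≤μ , Vv) ∷ supp) = (0≤μ , F-maps _ Vv) ∷ mapSupp cs supp

module _ {m k} {V : Point m → Set} {W : Point k → Set} {F : Point m → Point k} {G : Point k → Point m}
  (F-affine : IsAffineMap F) (G-affine : IsAffineMap G)
  (F-maps : ∀ v → V v → W (F v))
  (G∘F≈id : ∀ v → V v → G (F v) ≈ₚ v)
  (F-onto : ∀ w → W w → Σ (Point m) λ v → V v × F v ≈ₚ w) where

  private
    G∘F≈id-hull : ∀ x → ConvexHull V x → G (F x) ≈ₚ x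
    G∘F≈id-hull x (cs , supp , w≡1 , x≈) i = begin
        G (F x) i
      ≡⟨ affine-cong (affineMap-∘ G-affine F-affine i) x≈ ⟩
        G (F (combine cs)) i
      ≡⟨ affine-combine (affineMap-∘ G-affine F-affine i) cs w≡1 ⟩
        sumList (λ p → proj₁ p * G (F (proj₂ p)) i) cs
      ≡⟨ fixed cs supp ⟩
        combine cs i
      ≡⟨ sym (x≈ i) ⟩
        x i ∎
      where
      open ≡-Reasoning
      fixed : (cs : Combination m) → Supported V cs → sumList (λ p → proj₁ p * G (F (proj₂ p)) i) cs ≡ combine cs i
      fixed [] [] = refl
      fixed (p ∷ cs) ((_ , Vv) ∷ supp) = cong₂ _+_ (cong (proj₁ p *_) (G∘F≈id _ Vv i)) (fixed cs supp)

    liftPoints : (cs : Combination k) → Supported W cs →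
      Σ (Combination m) λ cs' → Supported V cs' × weight cs' ≡ weight cs × combine (mapPoints F cs') ≈ₚ combine cs
    liftPoints [] [] = [] , [] , refl , λ _ → refl
    liftPoints ((μ , w) ∷ cs) ((0≤μ , Ww) ∷ supp) =
      let (v , Vv , Fv≈w) = F-onto w Ww
          (cs' , supp' , weight≡ , combine≈) = liftPoints cs supp
      in (μ , v) ∷ cs' , (0≤μ , Vv) ∷ supp' , cong (μ +_) weight≡ ,
         λ j → cong₂ _+_ (cong (μ *_) (Fv≈w j)) (combine≈ j)

    F-hull-onto : ∀ z → ConvexHull W z → Σ (Point m) λ x → ConvexHull V x × F x ≈ₚ z
    F-hull-onto z (cs , supp , w≡1 , z≈) =
      let (cs' , supp' , weight≡ , combine≈) = liftPoints cs supp
          w'≡1 = trans weight≡ w≡1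
      in combine cs' , (cs' , supp' , w'≡1 , λ _ → refl) ,
         λ j → trans (affineMap-combine F-affine cs' w'≡1 j) (trans (combine≈ j) (sym (z≈ j)))

  hull-affinelyIsomorphic : AffinelyIsomorphic (ConvexHull V) (ConvexHull W)
  hull-affinelyIsomorphic = toAffine F-affine , into , injective , onto
    where
    open ≡-Reasoning
    into : ∀ x → ConvexHull V x → ConvexHull W (applyAff (toAffine F-affine) x)
    into x hx = let (cs , supp , w≡1 , Fx≈) = hull-image F-affine F-maps x hx in
      cs , supp , w≡1 , λ j → trans (applyAff-toAffine F-affine x j) (Fx≈ j)
    injective : ∀ x y → ConvexHull V x → ConvexHull V y →
      applyAff (toAffine F-affine) x ≈ₚ applyAff (toAffine F-affine) y → x ≈ₚ y
    injective x y hx hy fx≈fy i = begin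
        x i         ≡⟨ sym (G∘F≈id-hull x hx i) ⟩
        G (F x) i   ≡⟨ affine-cong (G-affine i) Fx≈Fy ⟩
        G (F y) i   ≡⟨ G∘F≈id-hull y hy i ⟩
        y i         ∎
      where
      Fx≈Fy : F x ≈ₚ F y
      Fx≈Fy j = trans (sym (applyAff-toAffine F-affine x j)) (trans (fx≈fy j) (applyAff-toAffine F-affine y j))
    onto : ∀ z → ConvexHull W z → Σ (Point m) λ x → ConvexHull V x × applyAff (toAffine F-affine) x ≈ₚ z
    onto z hz = let (x , hx , Fx≈z) = F-hull-onto z hz in
      x , hx , λ j → trans (applyAff-toAffine F-affine x j) (Fx≈z j)

affinelyIsomorphic-resp : ∀ {m k} {P P' : Point m → Set} {Q Q' : Point k → Set} →
  (∀ x → P x ⇔ P' x) → (∀ z → Q z ⇔ Q' z) → AffinelyIsomorphic P' Q' → AffinelyIsomorphic P Q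
affinelyIsomorphic-resp P⇔P' Q⇔Q' (f , into , injective , onto) =
  f ,
  (λ x Px → from (Q⇔Q' _) (into x (to (P⇔P' x) Px))) ,
  (λ x y Px Py → injective x y (to (P⇔P' x) Px) (to (P⇔P' y) Py)) ,
  λ z Qz → let (x , P'x , fx≈z) = onto z (to (Q⇔Q' z) Qz) in x , from (P⇔P' x) P'x , fx≈z

≗-++ : ∀ {A : Set} {m k} (x : Fin (m ℕ.+ k) → A) (u : Fin m → A) (v : Fin k → A) →
  (∀ i → x (i ↑ˡ k) ≡ u i) → (∀ i → x (m ↑ʳ i) ≡ v i) → ∀ j → x j ≡ (u ++ v) j
≗-++ {m = m} {k} x u v left right j with splitAt m j in eq
... | inj₁ i = trans (cong x (sym (FinP.join-splitAt m k j))) (trans (cong (λ s → x (F.join m k s)) eq) (left i))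
... | inj₂ i = trans (cong x (sym (FinP.join-splitAt m k j))) (trans (cong (λ s → x (F.join m k s)) eq) (right i))

_⊗_ : ∀ {m k} → (Point m → Set) → (Point k → Set) → Point (m ℕ.+ k) → Set
_⊗_ {m} V W z = V (take m z) × W (drop m z)

module _ {m k} {V : Point m → Set} {W : Point k → Set} where

  hull-⊗⁻ : ∀ z → ConvexHull (V ⊗ W) z → ConvexHull V (take m z) × ConvexHull W (drop m z)
  hull-⊗⁻ z hz = hull-image (affineMap-take m) (λ _ → proj₁) z hz , hull-image (affineMap-drop m) (λ _ → proj₂) z hz

  private
    pairWith : ℚ × Point m → Combination k → Combination (m ℕ.+ k)
    pairWith (μ , v) = map (λ (ν , w) → μ * ν , v ++ w)

    productComb : Combination m → Combination k → Combination (m ℕ.+ k)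
    productComb cs₁ cs₂ = concatMap (λ p → pairWith p cs₂) cs₁

    combine-productComb : ∀ cs₁ cs₂ j → combine (productComb cs₁ cs₂) j ≡
      sumList (λ p → sumList (λ q → (proj₁ p * proj₁ q) * (proj₂ p ++ proj₂ q) j) cs₂) cs₁
    combine-productComb cs₁ cs₂ j =
      trans (sumList-concatMap _ (λ p → pairWith p cs₂) cs₁) (sumList-cong cs₁ (λ p → sumList-map _ _ cs₂))

    module _ (cs₁ : Combination m) {cs₂ : Combination k} (w₂≡1 : weight cs₂ ≡ 1ℚ) where

      weight-productComb : weight (productComb cs₁ cs₂) ≡ weight cs₁
      weight-productComb = trans (sumList-concatMap proj₁ (λ p → pairWith p cs₂) cs₁) (sumList-cong cs₁ pairWeight)
        where
        pairWeight : ∀ p → weight (pairWith p cs₂) ≡ proj₁ p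
        pairWeight p = trans (sumList-map proj₁ _ cs₂)
          (trans (sumList-* (proj₁ p) proj₁ cs₂) (trans (cong (proj₁ p *_) w₂≡1) (ℚP.*-identityʳ _)))

      combine-productComb-↑ˡ : ∀ i → combine (productComb cs₁ cs₂) (i ↑ˡ k) ≡ combine cs₁ i
      combine-productComb-↑ˡ i = trans (combine-productComb cs₁ cs₂ _) (sumList-cong cs₁ inner)
        where
        open ≡-Reasoning
        inner : ∀ p → sumList (λ q → (proj₁ p * proj₁ q) * (proj₂ p ++ proj₂ q) (i ↑ˡ k)) cs₂ ≡ proj₁ p * proj₂ p i
        inner (μ , v) = begin
            sumList (λ q → (μ * proj₁ q) * (v ++ proj₂ q) (i ↑ˡ k)) cs₂
          ≡⟨ sumList-cong cs₂ (λ (ν , w) → trans (cong ((μ * ν) *_) (lookup-++ˡ v w i))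
               (solve 3 (λ a b c → (a :* b) :* c := (a :* c) :* b) refl μ ν (v i))) ⟩
            sumList (λ q → (μ * v i) * proj₁ q) cs₂
          ≡⟨ sumList-* (μ * v i) proj₁ cs₂ ⟩
            (μ * v i) * weight cs₂
          ≡⟨ trans (cong ((μ * v i) *_) w₂≡1) (ℚP.*-identityʳ _) ⟩
            μ * v i ∎

    combine-productComb-↑ʳ : ∀ cs₁ cs₂ → weight cs₁ ≡ 1ℚ → ∀ i → combine (productComb cs₁ cs₂) (m ↑ʳ i) ≡ combine cs₂ i
    combine-productComb-↑ʳ cs₁ cs₂ w₁≡1 i = begin
        combine (productComb cs₁ cs₂) (m ↑ʳ i)
      ≡⟨ trans (combine-productComb cs₁ cs₂ _) (sumList-cong cs₁ inner) ⟩
        sumList (λ p → proj₁ p * combine cs₂ i) cs₁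
      ≡⟨ sumList-*ʳ (combine cs₂ i) proj₁ cs₁ ⟩
        weight cs₁ * combine cs₂ i
      ≡⟨ trans (cong (_* combine cs₂ i) w₁≡1) (ℚP.*-identityˡ _) ⟩
        combine cs₂ i ∎
      where
      open ≡-Reasoning
      inner : ∀ p → sumList (λ q → (proj₁ p * proj₁ q) * (proj₂ p ++ proj₂ q) (m ↑ʳ i)) cs₂ ≡ proj₁ p * combine cs₂ i
      inner (μ , v) = trans (sumList-cong cs₂ (λ (ν , w) → trans (cong ((μ * ν) *_) (lookup-++ʳ v w i)) (ℚP.*-assoc μ ν (w i))))
                            (sumList-* μ _ cs₂)

  module _ (V-resp : ∀ {x y} → x ≈ₚ y → V x → V y) (W-resp : ∀ {x y} → x ≈ₚ y → W x → W y) where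

    supported-productComb : ∀ cs₁ cs₂ → Supported V cs₁ → Supported W cs₂ → Supported (V ⊗ W) (productComb cs₁ cs₂)
    supported-productComb [] cs₂ [] supp₂ = []
    supported-productComb ((μ , v) ∷ cs₁) cs₂ ((0≤μ , Vv) ∷ supp₁) supp₂ =
      AllP.++⁺ (pairs cs₂ supp₂) (supported-productComb cs₁ cs₂ supp₁ supp₂)
      where
      pairs : ∀ cs₂ → Supported W cs₂ → Supported (V ⊗ W) (pairWith (μ , v) cs₂)
      pairs [] [] = []
      pairs ((ν , w) ∷ cs₂) ((0≤ν , Ww) ∷ supp₂) =
        (0≤* 0≤μ 0≤ν , V-resp (λ i → sym (lookup-++ˡ v w i)) Vv , W-resp (λ i → sym (lookup-++ʳ v w i)) Ww) ∷ pairs cs₂ supp₂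

    hull-⊗⁺ : ∀ z → ConvexHull V (take m z) → ConvexHull W (drop m z) → ConvexHull (V ⊗ W) z
    hull-⊗⁺ z (cs₁ , supp₁ , w₁≡1 , z₁≈) (cs₂ , supp₂ , w₂≡1 , z₂≈) =
      productComb cs₁ cs₂ , supported-productComb cs₁ cs₂ supp₁ supp₂ , trans (weight-productComb cs₁ w₂≡1) w₁≡1 ,
      λ j → trans (≗-++ z _ _ z₁≈ z₂≈ j)
        (sym (≗-++ (combine (productComb cs₁ cs₂)) _ _ (combine-productComb-↑ˡ cs₁ w₂≡1) (combine-productComb-↑ʳ cs₁ cs₂ w₁≡1) j))

-- 0/1 vectors and the difference operator

≤ᵇ-true : ∀ {m n} → m ℕ.≤ n → (m ℕ.≤ᵇ n) ≡ true
≤ᵇ-true m≤n = to BoolP.T-≡ (ℕP.≤⇒≤ᵇ m≤n)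

≤ᵇ-true⁻¹ : ∀ {m n} → (m ℕ.≤ᵇ n) ≡ true → m ℕ.≤ n
≤ᵇ-true⁻¹ {m} {n} eq = ℕP.≤ᵇ⇒≤ m n (from BoolP.T-≡ eq)

≤ᵇ-false : ∀ {m n} → n ℕ.< m → (m ℕ.≤ᵇ n) ≡ false
≤ᵇ-false {m} {n} n<m with m ℕ.≤ᵇ n in eq
... | false = refl
... | true = ⊥-elim (ℕP.<⇒≱ n<m (≤ᵇ-true⁻¹ eq))

≤ᵇ-false⁻¹ : ∀ {m n} → (m ℕ.≤ᵇ n) ≡ false → n ℕ.< m
≤ᵇ-false⁻¹ eq = ℕP.≰⇒> (λ m≤n → BoolP.not-¬ refl (trans (sym (≤ᵇ-true m≤n)) eq))

<ᵇ-true : ∀ {m n} → m ℕ.< n → (m ℕ.<ᵇ n) ≡ true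
<ᵇ-true = ≤ᵇ-true

<ᵇ-false : ∀ {m n} → n ℕ.≤ m → (m ℕ.<ᵇ n) ≡ false
<ᵇ-false n≤m = ≤ᵇ-false (ℕ.s≤s n≤m)

<ᵇ-suc : ∀ m n → (m ℕ.<ᵇ suc n) ≡ (m ℕ.≤ᵇ n)
<ᵇ-suc zero n = refl
<ᵇ-suc (suc m) n = refl

≡ᵇ-refl : ∀ m → (m ℕ.≡ᵇ m) ≡ true
≡ᵇ-refl m = to BoolP.T-≡ (ℕP.≡⇒≡ᵇ m m refl)

≡ᵇ-false : ∀ {m n} → m ≢ n → (m ℕ.≡ᵇ n) ≡ false
≡ᵇ-false {m} {n} m≢n with m ℕ.≡ᵇ n in eq
... | false = refl
... | true = ⊥-elim (m≢n (ℕP.≡ᵇ⇒≡ m n (from BoolP.T-≡ eq)))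

BitVec : ℕ → Set
BitVec n = Fin n → Bool

bit : Bool → ℚ
bit true = 1ℚ
bit false = 0ℚ

bits : ∀ {n} → BitVec n → Point n
bits y i = bit (y i)

bit-injective : ∀ {a b} → bit a ≡ bit b → a ≡ b
bit-injective {true} {true} _ = refl
bit-injective {false} {false} _ = refl
bit-injective {true} {false} 1≡0 = ⊥-elim (toWitnessFalse {a? = 1ℚ ℚP.≟ 0ℚ} tt 1≡0)
bit-injective {false} {true} 0≡1 = ⊥-elim (toWitnessFalse {a? = 0ℚ ℚP.≟ 1ℚ} tt 0≡1)

bit-nonNeg : ∀ b → 0ℚ ≤ bit b
bit-nonNeg true = 0≤1
bit-nonNeg false = ℚP.≤-refl

prev : ∀ {n} → Bool → BitVec n → Fin n → Bool
prev p y zero = p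
prev p y (suc i) = y (inject₁ i)

prev-suc : ∀ {n} p (y : BitVec (suc n)) (i : Fin n) → prev p y (suc i) ≡ prev (y zero) (tail y) i
prev-suc p y zero = refl
prev-suc p y (suc i) = refl

shift : ∀ {n} → ℚ → Point n → Point n
shift c w zero = c
shift c w (suc i) = w (inject₁ i)

diffFrom : ∀ {n} → ℚ → Point n → Point n
diffFrom c w i = w i - shift c w i

diff : ∀ {n} → Point n → Point n
diff = diffFrom 0ℚ

prefixSum : ∀ {n} → Point n → Point n
prefixSum {suc n} w zero = w zero
prefixSum {suc n} w (suc i) = w zero + prefixSum (tail w) i

affineMap-diff : ∀ {n} → IsAffineMap (diff {n})
affineMap-diff zero = affine-- (affine-proj zero) (affine-const 0ℚ)
affineMap-diff (suc i) = affine-- (affine-proj (suc i)) (affine-proj (inject₁ i))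

affineMap-prefixSum : ∀ {n} → IsAffineMap (prefixSum {n})
affineMap-prefixSum {suc n} zero = affine-proj zero
affineMap-prefixSum {suc n} (suc i) = affine-+ (affine-proj zero) (affine-∘ (affineMap-prefixSum i) (λ j → affine-proj (suc j)))

prefixSum-diffFrom : ∀ {n} (c : ℚ) (u : Point n) i → prefixSum (diffFrom c u) i ≡ u i - c
prefixSum-diffFrom {suc n} c u zero = refl
prefixSum-diffFrom {suc n} c u (suc i) = begin
    (u zero - c) + prefixSum (tail (diffFrom c u)) i
  ≡⟨ cong ((u zero - c) +_) (affine-cong (affineMap-prefixSum i) tail-diffFrom) ⟩
    (u zero - c) + prefixSum (diffFrom (u zero) (tail u)) i
  ≡⟨ cong ((u zero - c) +_) (prefixSum-diffFrom (u zero) (tail u) i) ⟩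
    (u zero - c) + (u (suc i) - u zero)
  ≡⟨ solve 3 (λ a b d → (a :- d) :+ (b :- a) := b :- d) refl (u zero) (u (suc i)) c ⟩
    u (suc i) - c ∎
  where
  open ≡-Reasoning
  tail-diffFrom : tail (diffFrom c u) ≈ₚ diffFrom (u zero) (tail u)
  tail-diffFrom zero = refl
  tail-diffFrom (suc j) = refl

prefixSum-diff : ∀ {n} (u : Point n) → prefixSum (diff u) ≈ₚ u
prefixSum-diff u i = trans (prefixSum-diffFrom 0ℚ u i) (ℚP.+-identityʳ _)

diff-+ : ∀ {n} (u v : Point n) i → diff (λ j → u j + v j) i ≡ diff u i + diff v i
diff-+ u v zero = solve 2 (λ a b → (a :+ b) :- con 0ℚ := (a :- con 0ℚ) :+ (b :- con 0ℚ)) refl (u zero) (v zero)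
diff-+ u v (suc i) = solve 4 (λ a b c d → (a :+ b) :- (c :+ d) := (a :- c) :+ (b :- d)) refl
  (u (suc i)) (v (suc i)) (u (inject₁ i)) (v (inject₁ i))

diff-- : ∀ {n} (u v : Point n) i → diff (λ j → u j - v j) i ≡ diff u i - diff v i
diff-- u v zero = solve 2 (λ a b → (a :- b) :- con 0ℚ := (a :- con 0ℚ) :- (b :- con 0ℚ)) refl (u zero) (v zero)
diff-- u v (suc i) = solve 4 (λ a b c d → (a :- b) :- (c :- d) := (a :- c) :- (b :- d)) refl
  (u (suc i)) (v (suc i)) (u (inject₁ i)) (v (inject₁ i))

diff-0 : ∀ {n} i → diff {n} (λ _ → 0ℚ) i ≡ 0ℚ
diff-0 zero = refl
diff-0 (suc i) = refl

δ : ∀ {n} → BitVec n → Point n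
δ y = diff (bits y)

δ-prev : ∀ {n} (y : BitVec n) i → δ y i ≡ bit (y i) - bit (prev false y i)
δ-prev y zero = refl
δ-prev y (suc i) = refl

heaviside : ∀ {n} → ℕ → Point n
heaviside X i = bit (X ℕ.≤ᵇ toℕ i)

e-toℕ : ∀ {m} (j i : Fin m) → e j i ≡ bit (toℕ i ℕ.≡ᵇ toℕ j)
e-toℕ j i with i F.≟ j
... | yes refl = sym (cong bit (≡ᵇ-refl (toℕ i)))
... | no i≢j = sym (cong bit (≡ᵇ-false (λ eq → i≢j (FinP.toℕ-injective eq))))

diff-heaviside : ∀ {n} (x : Fin n) i → diff (heaviside (toℕ x)) i ≡ e x i
diff-heaviside x zero = trans (ℚP.+-identityʳ _) (trans (jump₀ (toℕ x)) (sym (e-toℕ x zero)))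
  where
  jump₀ : ∀ X → bit (X ℕ.≤ᵇ 0) ≡ bit (0 ℕ.≡ᵇ X)
  jump₀ zero = refl
  jump₀ (suc X) = refl
diff-heaviside x (suc i) = begin
    bit (toℕ x ℕ.≤ᵇ suc (toℕ i)) - bit (toℕ x ℕ.≤ᵇ toℕ (inject₁ i))
  ≡⟨ cong (λ t → bit (toℕ x ℕ.≤ᵇ suc (toℕ i)) - bit (toℕ x ℕ.≤ᵇ t)) (FinP.toℕ-inject₁ i) ⟩
    bit (toℕ x ℕ.≤ᵇ suc (toℕ i)) - bit (toℕ x ℕ.≤ᵇ toℕ i)
  ≡⟨ jump (toℕ x) (toℕ i) ⟩
    bit (suc (toℕ i) ℕ.≡ᵇ toℕ x)
  ≡⟨ sym (e-toℕ x (suc i)) ⟩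
    e x (suc i) ∎
  where
  open ≡-Reasoning
  jump : ∀ X k → bit (X ℕ.≤ᵇ suc k) - bit (X ℕ.≤ᵇ k) ≡ bit (suc k ℕ.≡ᵇ X)
  jump zero k = refl
  jump (suc zero) zero = refl
  jump (suc (suc X)) zero = refl
  jump (suc X) (suc k) rewrite <ᵇ-suc X (suc k) | <ᵇ-suc X k = jump X k

-- Feasible 0/1 vectors and alternating matchings

interiorRule : Bool → Bool → Bool → Bool
interiorRule true p c = not p ∨ c
interiorRule false p c = not c ∨ p

rule : ℕ → ℕ → ℕ → Bool → Bool → Bool → Bool
rule k a b ι p c =
  if k ℕ.<ᵇ a then not c else (if k ℕ.≡ᵇ a then true else (if k ℕ.<ᵇ b then interiorRule ι p c else not c))

localRule : ∀ {n} → Arc n → Fin n → Bool → Bool → Bool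
localRule α i p c = rule (toℕ i) (toℕ (a α)) (toℕ (b α)) (inA α i) p c

Feasible : ∀ {n} → Arc n → BitVec n → Set
Feasible α y = ∀ i → localRule α i (prev false y i) (y i) ≡ true

module _ {n} (α : Arc n) (i : Fin n) {p c : Bool} where

  localRule-< : toℕ i ℕ.< toℕ (a α) → localRule α i p c ≡ not c
  localRule-< i<a rewrite <ᵇ-true i<a = refl

  localRule-≡ : toℕ i ≡ toℕ (a α) → localRule α i p c ≡ true
  localRule-≡ i≡a rewrite i≡a | <ᵇ-false {toℕ (a α)} ℕP.≤-refl | ≡ᵇ-refl (toℕ (a α)) = refl

  localRule-interior : Interior α i → localRule α i p c ≡ interiorRule (inA α i) p c
  localRule-interior (a<i , i<b)
    rewrite <ᵇ-false (ℕP.<⇒≤ a<i) | ≡ᵇ-false (λ i≡a → ℕP.<-irrefl (sym i≡a) a<i) | <ᵇ-true i<b = refl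

  localRule-≥ : toℕ (b α) ℕ.≤ toℕ i → localRule α i p c ≡ not c
  localRule-≥ b≤i = helper (ℕP.<-≤-trans (a<b α) b≤i)
    where
    helper : toℕ (a α) ℕ.< toℕ i → localRule α i p c ≡ not c
    helper a<i rewrite <ᵇ-false (ℕP.<⇒≤ a<i) | ≡ᵇ-false (λ i≡a → ℕP.<-irrefl (sym i≡a) a<i) | <ᵇ-false b≤i = refl

not≡true : ∀ {c} → not c ≡ true → c ≡ false
not≡true {false} _ = refl

module _ {n} (α : Arc n) (y : BitVec n) where

  feasible-intro :
    (∀ i → toℕ i ℕ.< toℕ (a α) → y i ≡ false) →
    (∀ i → toℕ (b α) ℕ.≤ toℕ i → y i ≡ false) →
    (∀ i → Interior α i → interiorRule (inA α i) (prev false y i) (y i) ≡ true) → Feasible α y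
  feasible-intro before after interior i with ℕP.<-cmp (toℕ i) (toℕ (a α))
  ... | tri< i<a _ _ = trans (localRule-< α i i<a) (cong not (before i i<a))
  ... | tri≈ _ i≡a _ = localRule-≡ α i i≡a
  ... | tri> _ _ a<i with toℕ i <? toℕ (b α)
  ...   | yes i<b = trans (localRule-interior α i (a<i , i<b)) (interior i (a<i , i<b))
  ...   | no i≮b = trans (localRule-≥ α i (ℕP.≮⇒≥ i≮b)) (cong not (after i (ℕP.≮⇒≥ i≮b)))

  module _ (feasible : Feasible α y) where

    feasible-before : ∀ i → toℕ i ℕ.< toℕ (a α) → y i ≡ false
    feasible-before i i<a = not≡true (trans (sym (localRule-< α i i<a)) (feasible i))

    feasible-after : ∀ i → toℕ (b α) ℕ.≤ toℕ i → y i ≡ false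
    feasible-after i b≤i = not≡true (trans (sym (localRule-≥ α i b≤i)) (feasible i))

    feasible-interior : ∀ i → Interior α i → interiorRule (inA α i) (prev false y i) (y i) ≡ true
    feasible-interior i int = trans (sym (localRule-interior α i int)) (feasible i)

    feasible-support : ∀ i → y i ≡ true → (toℕ (a α) ℕ.≤ toℕ i) × (toℕ i ℕ.< toℕ (b α))
    feasible-support i yi≡true =
      ℕP.≮⇒≥ (λ i<a → BoolP.not-¬ yi≡true (feasible-before i i<a)) ,
      ℕP.≰⇒> (λ b≤i → BoolP.not-¬ yi≡true (feasible-after i b≤i))

inPair : ∀ {n} → Fin n × Fin n → Fin n → Bool
inPair (x , z) i = (toℕ x ℕ.≤ᵇ toℕ i) ∧ not (toℕ z ℕ.≤ᵇ toℕ i)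

coverage : ∀ {n} → Matching n → BitVec n
coverage [] i = false
coverage (q ∷ M) i = inPair q i ∨ coverage M i

bit-inPair : ∀ {n} (x z : Fin n) → toℕ x ℕ.≤ toℕ z → ∀ i → bit (inPair (x , z) i) ≡ heaviside (toℕ x) i - heaviside (toℕ z) i
bit-inPair x z x≤z i with toℕ z ℕ.≤ᵇ toℕ i in eq
... | true rewrite ≤ᵇ-true (ℕP.≤-trans x≤z (≤ᵇ-true⁻¹ eq)) = refl
... | false with toℕ x ℕ.≤ᵇ toℕ i
...   | true = refl
...   | false = refl

inPair-< : ∀ {n} (x z i : Fin n) → inPair (x , z) i ≡ true → toℕ i ℕ.< toℕ z
inPair-< x z i eq with toℕ z ℕ.≤ᵇ toℕ i in eq'
... | false = ≤ᵇ-false⁻¹ eq'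
... | true rewrite BoolP.∧-zeroʳ (toℕ x ℕ.≤ᵇ toℕ i) with eq
... | ()

coverage-before : ∀ {n} (M : Matching n) i → All (λ q → toℕ i ℕ.< toℕ (proj₁ q)) M → coverage M i ≡ false
coverage-before [] i [] = refl
coverage-before ((x , z) ∷ M) i (i<x ∷ hs) rewrite ≤ᵇ-false i<x = coverage-before M i hs

coverage-after : ∀ {n} (M : Matching n) i → All (λ q → toℕ (proj₂ q) ℕ.≤ toℕ i) M → coverage M i ≡ false
coverage-after [] i [] = refl
coverage-after ((x , z) ∷ M) i (z≤i ∷ hs) rewrite ≤ᵇ-true z≤i | BoolP.∧-zeroʳ (toℕ x ℕ.≤ᵇ toℕ i) = coverage-after M i hs

chain-tail : ∀ {n} (q : Fin n × Fin n) M → Chain (q ∷ M) → Chain M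
chain-tail q [] _ = tt
chain-tail q (q' ∷ M) (_ , chain) = chain

module _ {n} (α : Arc n) where

  chain-sorted : ∀ x z M → All (GoodPair α) ((x , z) ∷ M) → Chain ((x , z) ∷ M) → All (λ q → toℕ z ℕ.< toℕ (proj₁ q)) M
  chain-sorted x z [] _ _ = []
  chain-sorted x z ((x' , z') ∷ M) (_ ∷ good' ∷ goods) (z<x' , chain) =
    z<x' ∷ All.map (ℕP.<-trans (ℕP.<-trans z<x' (proj₂ (proj₂ good')))) (chain-sorted x' z' M (good' ∷ goods) chain)

  bits-coverage-∷ : ∀ x z M → All (GoodPair α) ((x , z) ∷ M) → Chain ((x , z) ∷ M) → ∀ i →
    bits (coverage ((x , z) ∷ M)) i ≡ bit (inPair (x , z) i) + bits (coverage M) i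
  bits-coverage-∷ x z M goods chain i with inPair (x , z) i in eq
  ... | false = sym (ℚP.+-identityˡ _)
  ... | true rewrite coverage-before M i (All.map (ℕP.<-trans (inPair-< x z i eq)) (chain-sorted x z M goods chain)) = refl

  χ≈δ-coverage : ∀ M → Alternating α M → χ M ≈ₚ δ (coverage M)
  χ≈δ-coverage [] _ i = sym (diff-0 i)
  χ≈δ-coverage ((x , z) ∷ M) (good ∷ goods , chain) i = sym (begin
      diff (bits (coverage ((x , z) ∷ M))) i
    ≡⟨ affineMap-cong affineMap-diff split i ⟩
      diff (λ j → (heaviside (toℕ x) j - heaviside (toℕ z) j) + bits (coverage M) j) i
    ≡⟨ diff-+ (λ j → heaviside (toℕ x) j - heaviside (toℕ z) j) (bits (coverage M)) i ⟩
      diff (λ j → heaviside (toℕ x) j - heaviside (toℕ z) j) i + δ (coverage M) i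
    ≡⟨ cong₂ _+_ (trans (diff-- (heaviside (toℕ x)) (heaviside (toℕ z)) i) (cong₂ _-_ (diff-heaviside x i) (diff-heaviside z i)))
                 (sym (χ≈δ-coverage M (goods , chain-tail _ M chain) i)) ⟩
      (e x i - e z i) + χ M i ∎)
    where
    open ≡-Reasoning
    split : bits (coverage ((x , z) ∷ M)) ≈ₚ (λ j → (heaviside (toℕ x) j - heaviside (toℕ z) j) + bits (coverage M) j)
    split j = trans (bits-coverage-∷ x z M (good ∷ goods) chain j)
                    (cong (_+ bits (coverage M) j) (bit-inPair x z (ℕP.<⇒≤ (proj₂ (proj₂ good))) j))

e-nonNeg : ∀ {n} (x i : Fin n) → 0ℚ ≤ e x i
e-nonNeg x i rewrite e-toℕ x i = bit-nonNeg (toℕ i ℕ.≡ᵇ toℕ x)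

χ-nonNeg : ∀ {n} (M : Matching n) i → All (λ q → proj₂ q ≢ i) M → 0ℚ ≤ χ M i
χ-nonNeg [] i _ = ℚP.≤-refl
χ-nonNeg ((x , z) ∷ M) i (z≢i ∷ hs) rewrite e-≢ i z (λ i≡z → z≢i (sym i≡z)) =
  ℚP.+-mono-≤ (subst (0ℚ ≤_) (sym (ℚP.+-identityʳ (e x i))) (e-nonNeg x i)) (χ-nonNeg M i hs)

χ-nonPos : ∀ {n} (M : Matching n) i → All (λ q → proj₁ q ≢ i) M → χ M i ≤ 0ℚ
χ-nonPos [] i _ = ℚP.≤-refl
χ-nonPos ((x , z) ∷ M) i (x≢i ∷ hs) rewrite e-≢ i x (λ i≡x → x≢i (sym i≡x)) =
  ℚP.+-mono-≤ {y = 0ℚ} {v = 0ℚ} (subst (_≤ 0ℚ) (sym (ℚP.+-identityˡ (- e z i))) (ℚP.neg-antimono-≤ (e-nonNeg z i)))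
    (χ-nonPos M i hs)

-- A vertex χ(M) is ≥ 0 at A-points (no right endpoint there) and ≤ 0 at B-points,
-- which is exactly the interior rule for the coverage vector.
coverage-feasible : ∀ {n} (α : Arc n) (M : Matching n) → Alternating α M → Feasible α (coverage M)
coverage-feasible α M (goods , chain) = feasible-intro α (coverage M) before after interior
  where
  y = coverage M
  χ≡ : ∀ i → χ M i ≡ bit (y i) - bit (prev false y i)
  χ≡ i = trans (χ≈δ-coverage α M (goods , chain) i) (δ-prev y i)
  before : ∀ i → toℕ i ℕ.< toℕ (a α) → y i ≡ false
  before i i<a = coverage-before M i (All.map (λ good → ℕP.<-≤-trans i<a (a≤left (proj₁ good))) goods)
    where
    a≤left : ∀ {x} → IsLeft α x → toℕ (a α) ℕ.≤ toℕ x
    a≤left (inj₁ refl) = ℕP.≤-refl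
    a≤left (inj₂ ((a<x , _) , _)) = ℕP.<⇒≤ a<x
  after : ∀ i → toℕ (b α) ℕ.≤ toℕ i → y i ≡ false
  after i b≤i = coverage-after M i (All.map (λ good → ℕP.≤-trans (right≤b (proj₁ (proj₂ good))) b≤i) goods)
    where
    right≤b : ∀ {z} → IsRight α z → toℕ z ℕ.≤ toℕ (b α)
    right≤b (inj₁ refl) = ℕP.≤-refl
    right≤b (inj₂ ((_ , z<b) , _)) = ℕP.<⇒≤ z<b
  interior : ∀ i → Interior α i → interiorRule (inA α i) (prev false y i) (y i) ≡ true
  interior i (a<i , i<b) with inA α i in eqA | prev false y i in eqp | y i in eqy
  ... | true | false | _ = refl
  ... | true | true | true = refl
  ... | true | true | false = ⊥-elim (toWitnessFalse {a? = 0ℚ ℚP.≤? (0ℚ - 1ℚ)} tt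
          (subst (0ℚ ≤_) (trans (χ≡ i) (cong₂ (λ u v → bit u - bit v) eqy eqp)) (χ-nonNeg M i (All.map (λ good → noRight (proj₁ (proj₂ good))) goods))))
    where
    noRight : ∀ {z} → IsRight α z → z ≢ i
    noRight (inj₁ refl) refl = ℕP.<-irrefl refl i<b
    noRight (inj₂ (_ , inA≡false)) refl with trans (sym eqA) inA≡false
    ... | ()
  ... | false | _ | false = refl
  ... | false | true | true = refl
  ... | false | false | true = ⊥-elim (toWitnessFalse {a? = (1ℚ - 0ℚ) ℚP.≤? 0ℚ} tt
          (subst (_≤ 0ℚ) (trans (χ≡ i) (cong₂ (λ u v → bit u - bit v) eqy eqp)) (χ-nonPos M i (All.map (λ good → noLeft (proj₁ good)) goods))))
    where
    noLeft : ∀ {x} → IsLeft α x → x ≢ i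
    noLeft (inj₁ refl) refl = ℕP.<-irrefl refl a<i
    noLeft (inj₂ (_ , inA≡true)) refl with trans (sym eqA) inA≡true
    ... | ()

liftPair : ∀ {n} → Fin n × Fin n → Fin (suc n) × Fin (suc n)
liftPair (x , z) = suc x , suc z

liftMatching : ∀ {n} → Matching n → Matching (suc n)
liftMatching = map liftPair

-- runs p y pairs up the starts and ends of the runs of ones of y, read with p as the bit before
-- position 0; when p = true the run open at position 0 has no start, and its end is returned apart.
runsStep : ∀ {n} → Bool → Bool → Maybe (Fin n) × Matching n → Maybe (Fin (suc n)) × Matching (suc n)
runsStep false false (c , M) = nothing , liftMatching M
runsStep false true (just c , M) = nothing , (zero , suc c) ∷ liftMatching M
runsStep false true (nothing , M) = nothing , liftMatching M
runsStep true false (c , M) = just zero , liftMatching M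
runsStep true true (c , M) = Maybe.map suc c , liftMatching M

runs : ∀ {n} → Bool → BitVec n → Maybe (Fin n) × Matching n
runs {zero} p y = nothing , []
runs {suc n} p y = runsStep p (y zero) (runs (y zero) (tail y))

EndsFalse : ∀ {n} → BitVec n → Set
EndsFalse {zero} y = ⊤
EndsFalse {suc m} y = y (F.fromℕ m) ≡ false

EndsFalse⁺ : ∀ {n} → BitVec n → Set
EndsFalse⁺ {zero} y = ⊥
EndsFalse⁺ {suc m} y = y (F.fromℕ m) ≡ false

endsFalse-tail : ∀ {n} (y : BitVec (suc n)) → EndsFalse y → EndsFalse (tail y)
endsFalse-tail {zero} y _ = tt
endsFalse-tail {suc n} y ends = ends

endsFalse⁺-tail : ∀ {n} (y : BitVec (suc n)) → EndsFalse y → y zero ≡ true → EndsFalse⁺ (tail y)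
endsFalse⁺-tail {zero} y ends y₀≡true with trans (sym y₀≡true) ends
... | ()
endsFalse⁺-tail {suc n} y ends _ = ends

δFrom : ∀ {n} → Bool → BitVec n → Point n
δFrom p y i = bit (y i) - bit (prev p y i)

pendingPoint : ∀ {n} → Maybe (Fin n) → Point n
pendingPoint nothing i = 0ℚ
pendingPoint (just c) i = e c i

RunPair : ∀ {n} → Bool → BitVec n → Fin n × Fin n → Set
RunPair p y (x , z) = (y x ≡ true) × (prev p y x ≡ false) × (y z ≡ false) × (prev p y z ≡ true) × (toℕ x ℕ.< toℕ z)

record RunsInvariant {n} (p : Bool) (y : BitVec n) (r : Maybe (Fin n) × Matching n) : Set where
  field
    noPendingEnd : p ≡ false → proj₁ r ≡ nothing
    pendingEnd : p ≡ true → EndsFalse⁺ y → Σ (Fin n) λ c → proj₁ r ≡ just c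
    χ-runs : EndsFalse y → ∀ i → δFrom p y i ≡ χ (proj₂ r) i - pendingPoint (proj₁ r) i
    runPairs : All (RunPair p y) (proj₂ r)
    pendingEnd-ok : ∀ c → proj₁ r ≡ just c →
      ((y c ≡ false) × (prev p y c ≡ true)) × All (λ q → toℕ c ℕ.< toℕ (proj₁ q)) (proj₂ r)
    chain : Chain (proj₂ r)

χ-lift-zero : ∀ {n} (M : Matching n) → χ (liftMatching M) zero ≡ 0ℚ
χ-lift-zero [] = refl
χ-lift-zero ((x , z) ∷ M) rewrite χ-lift-zero M = refl

χ-lift-suc : ∀ {n} (M : Matching n) i → χ (liftMatching M) (suc i) ≡ χ M i
χ-lift-suc [] i = refl
χ-lift-suc ((x , z) ∷ M) i rewrite χ-lift-suc M i | e-suc i x | e-suc i z = refl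

chain-lift : ∀ {n} (M : Matching n) → Chain M → Chain (liftMatching M)
chain-lift [] _ = tt
chain-lift (q ∷ []) _ = tt
chain-lift (q ∷ q' ∷ M) (z<x' , chain) = ℕ.s≤s z<x' , chain-lift (q' ∷ M) chain

chain-cons-lift : ∀ {n} (c : Fin n) M → Chain M → All (λ q → toℕ c ℕ.< toℕ (proj₁ q)) M →
  Chain ((zero , suc c) ∷ liftMatching M)
chain-cons-lift c [] _ _ = tt
chain-cons-lift c (q ∷ M) chain (c<x ∷ _) = ℕ.s≤s c<x , chain-lift (q ∷ M) chain

runPairs-lift : ∀ {n} p (y : BitVec (suc n)) (M : Matching n) →
  All (RunPair (y zero) (tail y)) M → All (RunPair p y) (liftMatching M)
runPairs-lift p y [] [] = []
runPairs-lift p y ((x , z) ∷ M) ((yx , px , yz , pz , x<z) ∷ hs) =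
  (yx , trans (prev-suc p y x) px , yz , trans (prev-suc p y z) pz , ℕ.s≤s x<z) ∷ runPairs-lift p y M hs

after-lift : ∀ {n} (M : Matching n) (c : ℕ) → All (λ q → c ℕ.< toℕ (proj₁ q)) M →
  All (λ q → suc c ℕ.< toℕ (proj₁ q)) (liftMatching M)
after-lift [] c [] = []
after-lift ((x , z) ∷ M) c (c<x ∷ hs) = ℕ.s≤s c<x ∷ after-lift M c hs

after-zero-lift : ∀ {n} (M : Matching n) → All (λ q → 0 ℕ.< toℕ (proj₁ q)) (liftMatching M)
after-zero-lift [] = []
after-zero-lift ((x , z) ∷ M) = ℕ.s≤s ℕ.z≤n ∷ after-zero-lift M

module _ {n} (y : BitVec (suc n)) where
  open RunsInvariant

  private
    lift-runPairs : ∀ p {b} → y zero ≡ b → ∀ {r} → RunsInvariant b (tail y) r → All (RunPair p y) (liftMatching (proj₂ r))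
    lift-runPairs p y₀≡b {_ , M} inv = runPairs-lift p y M (subst (λ t → All (RunPair t (tail y)) M) (sym y₀≡b) (runPairs inv))

    lift-pending : ∀ p {b} → y zero ≡ b → ∀ {r} → RunsInvariant b (tail y) r → ∀ c → proj₁ r ≡ just c →
      (y (suc c) ≡ false) × (prev p y (suc c) ≡ true)
    lift-pending p y₀≡b inv c eq = let ((yc , pc) , _) = pendingEnd-ok inv c eq in
      yc , trans (prev-suc p y c) (subst (λ t → prev t (tail y) c ≡ true) (sym y₀≡b) pc)

  runsStep-invariant : ∀ p b → y zero ≡ b → (r : Maybe (Fin n) × Matching n) →
    RunsInvariant b (tail y) r → RunsInvariant p y (runsStep p b r)
  runsStep-invariant false false y₀≡b (c , M) inv = record
    { noPendingEnd = λ _ → refl ; pendingEnd = λ () ; χ-runs = χ≡ ; runPairs = lift-runPairs false y₀≡b inv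
    ; pendingEnd-ok = λ _ () ; chain = chain-lift M (chain inv) }
    where
    χ≡ : EndsFalse y → ∀ i → δFrom false y i ≡ χ (liftMatching M) i - 0ℚ
    χ≡ ends zero rewrite y₀≡b | χ-lift-zero M = refl
    χ≡ ends (suc i) rewrite χ-lift-suc M i | prev-suc false y i | y₀≡b =
      trans (χ-runs inv (endsFalse-tail y ends) i) (cong (λ t → χ M i - pendingPoint t i) (noPendingEnd inv refl))
  runsStep-invariant false true y₀≡b (nothing , M) inv = record
    { noPendingEnd = λ _ → refl ; pendingEnd = λ () ; χ-runs = λ ends → ⊥-elim (unclosed ends)
    ; runPairs = lift-runPairs false y₀≡b inv ; pendingEnd-ok = λ _ () ; chain = chain-lift M (chain inv) }
    where
    unclosed : EndsFalse y → ⊥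
    unclosed ends with pendingEnd inv refl (endsFalse⁺-tail y ends y₀≡b)
    ... | _ , ()
  runsStep-invariant false true y₀≡b (just c , M) inv = record
    { noPendingEnd = λ _ → refl ; pendingEnd = λ () ; χ-runs = χ≡
    ; runPairs = (y₀≡b , refl , proj₁ pend , proj₂ pend , ℕ.s≤s ℕ.z≤n) ∷ lift-runPairs false y₀≡b inv
    ; pendingEnd-ok = λ _ () ; chain = chain-cons-lift c M (chain inv) (proj₂ (pendingEnd-ok inv c refl)) }
    where
    pend = lift-pending false y₀≡b inv c refl
    χ≡ : EndsFalse y → ∀ i → δFrom false y i ≡ χ ((zero , suc c) ∷ liftMatching M) i - 0ℚ
    χ≡ ends zero rewrite y₀≡b | χ-lift-zero M | e-same {suc n} zero | e-≢ zero (suc c) (λ ()) = refl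
    χ≡ ends (suc i) rewrite χ-lift-suc M i | prev-suc false y i | y₀≡b | e-suc i c | e-≢ (suc i) zero (λ ()) =
      trans (χ-runs inv (endsFalse-tail y ends) i)
        (solve 2 (λ a b → a :- b := ((con 0ℚ :- b) :+ a) :- con 0ℚ) refl (χ M i) (e c i))
  runsStep-invariant true false y₀≡b (c , M) inv = record
    { noPendingEnd = λ () ; pendingEnd = λ _ _ → zero , refl ; χ-runs = χ≡ ; runPairs = lift-runPairs true y₀≡b inv
    ; pendingEnd-ok = λ { _ refl → (y₀≡b , refl) , after-zero-lift M } ; chain = chain-lift M (chain inv) }
    where
    χ≡ : EndsFalse y → ∀ i → δFrom true y i ≡ χ (liftMatching M) i - e zero i
    χ≡ ends zero rewrite y₀≡b | χ-lift-zero M | e-same {suc n} zero = refl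
    χ≡ ends (suc i) rewrite χ-lift-suc M i | prev-suc true y i | y₀≡b | e-≢ (suc i) zero (λ ()) =
      trans (χ-runs inv (endsFalse-tail y ends) i) (cong (λ t → χ M i - pendingPoint t i) (noPendingEnd inv refl))
  runsStep-invariant true true y₀≡b (nothing , M) inv = record
    { noPendingEnd = λ () ; pendingEnd = λ _ ends → ⊥-elim (unclosed ends) ; χ-runs = λ ends → ⊥-elim (unclosed ends)
    ; runPairs = lift-runPairs true y₀≡b inv ; pendingEnd-ok = λ _ () ; chain = chain-lift M (chain inv) }
    where
    unclosed : EndsFalse y → ⊥
    unclosed ends with pendingEnd inv refl (endsFalse⁺-tail y ends y₀≡b)
    ... | _ , ()
  runsStep-invariant true true y₀≡b (just c , M) inv = record
    { noPendingEnd = λ () ; pendingEnd = λ _ _ → suc c , refl ; χ-runs = χ≡ ; runPairs = lift-runPairs true y₀≡b inv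
    ; pendingEnd-ok = λ { _ refl → lift-pending true y₀≡b inv c refl , after-lift M (toℕ c) (proj₂ (pendingEnd-ok inv c refl)) }
    ; chain = chain-lift M (chain inv) }
    where
    χ≡ : EndsFalse y → ∀ i → δFrom true y i ≡ χ (liftMatching M) i - e (suc c) i
    χ≡ ends zero rewrite y₀≡b | χ-lift-zero M | e-≢ zero (suc c) (λ ()) = refl
    χ≡ ends (suc i) rewrite χ-lift-suc M i | prev-suc true y i | y₀≡b | e-suc i c = χ-runs inv (endsFalse-tail y ends) i

runs-invariant : ∀ {n} p (y : BitVec n) → RunsInvariant p y (runs p y)
runs-invariant {zero} p y = record
  { noPendingEnd = λ _ → refl ; pendingEnd = λ _ () ; χ-runs = λ _ () ; runPairs = [] ; pendingEnd-ok = λ _ () ; chain = tt }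
runs-invariant {suc n} p y = runsStep-invariant y p (y zero) refl (runs (y zero) (tail y)) (runs-invariant (y zero) (tail y))

feasible-endsFalse : ∀ {n} (α : Arc n) (y : BitVec n) → Feasible α y → EndsFalse y
feasible-endsFalse {zero} α y _ = tt
feasible-endsFalse {suc m} α y feasible = feasible-after α y feasible (F.fromℕ m)
  (subst (toℕ (b α) ℕ.≤_) (sym (FinP.toℕ-fromℕ m)) (ℕP.≤-pred (FinP.toℕ<n (b α))))

module _ {n} (α : Arc n) (y : BitVec n) (feasible : Feasible α y) where

  private
    prev-support : ∀ z → prev false y z ≡ true → (toℕ (a α) ℕ.< toℕ z) × (toℕ z ℕ.≤ toℕ (b α))
    prev-support zero ()
    prev-support (suc j) pj≡true = let (a≤j , j<b) = feasible-support α y feasible (inject₁ j) pj≡true in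
      ℕ.s≤s (subst (toℕ (a α) ℕ.≤_) (FinP.toℕ-inject₁ j) a≤j) , subst (ℕ._< toℕ (b α)) (FinP.toℕ-inject₁ j) j<b

  runPair-good : ∀ q → RunPair false y q → GoodPair α q
  runPair-good (x , z) (yx , px , yz , pz , x<z) = left , right , x<z
    where
    x-support = feasible-support α y feasible x yx
    z-support = prev-support z pz
    left : IsLeft α x
    left with ℕP.<-cmp (toℕ (a α)) (toℕ x)
    ... | tri≈ _ a≡x _ = inj₁ (FinP.toℕ-injective (sym a≡x))
    ... | tri> _ _ x<a = ⊥-elim (ℕP.<-irrefl refl (ℕP.<-≤-trans x<a (proj₁ x-support)))
    ... | tri< a<x _ _ = inj₂ (int , inA-true (inA α x) refl)
      where
      int = a<x , proj₂ x-support
      inA-true : ∀ t → inA α x ≡ t → t ≡ true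
      inA-true true _ = refl
      inA-true false eq with trans (sym (feasible-interior α y feasible x int))
                                  (trans (cong₂ (λ u v → interiorRule u (prev false y x) v) eq yx) (cong (λ v → interiorRule false v true) px))
      ... | ()
    right : IsRight α z
    right with ℕP.<-cmp (toℕ z) (toℕ (b α))
    ... | tri≈ _ z≡b _ = inj₁ (FinP.toℕ-injective z≡b)
    ... | tri> _ _ b<z = ⊥-elim (ℕP.<-irrefl refl (ℕP.<-≤-trans b<z (proj₂ z-support)))
    ... | tri< z<b _ _ = inj₂ (int , inA-false (inA α z) refl)
      where
      int = proj₁ z-support , z<b
      inA-false : ∀ t → inA α z ≡ t → t ≡ false
      inA-false false _ = refl
      inA-false true eq with trans (sym (feasible-interior α y feasible z int))
                                  (trans (cong₂ (λ u v → interiorRule u (prev false y z) v) eq yz) (cong (λ v → interiorRule true v false) pz))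
      ... | ()

  feasible⇒matching : Σ (Matching n) λ M → Alternating α M × (δ y ≈ₚ χ M)
  feasible⇒matching = M , (All.map (runPair-good _) (runPairs inv) , chain inv) , λ i → begin
      δ y i
    ≡⟨ δ-prev y i ⟩
      δFrom false y i
    ≡⟨ χ-runs inv (feasible-endsFalse α y feasible) i ⟩
      χ M i - pendingPoint (proj₁ (runs false y)) i
    ≡⟨ cong (λ t → χ M i - pendingPoint t i) (noPendingEnd inv refl) ⟩
      χ M i - 0ℚ
    ≡⟨ ℚP.+-identityʳ _ ⟩
      χ M i ∎
    where
    open ≡-Reasoning
    open RunsInvariant
    M = proj₂ (runs false y)
    inv = runs-invariant false y

ShardVertex : ∀ {n} → Arc n → Point n → Set
ShardVertex {n} α v = Σ (BitVec n) λ y → Feasible α y × v ≈ₚ δ y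

shardVertex-resp : ∀ {n} (α : Arc n) {x x'} → x ≈ₚ x' → ShardVertex α x → ShardVertex α x'
shardVertex-resp α x≈x' (y , feasible , x≈δy) = y , feasible , λ i → trans (sym (x≈x' i)) (x≈δy i)

χ-shardVertex : ∀ {n} (α : Arc n) (M : Matching n) → Alternating α M → ShardVertex α (χ M)
χ-shardVertex α M alt = coverage M , coverage-feasible α M alt , χ≈δ-coverage α M alt

module _ {n} (α : Arc n) where

  private
    toCombination : List (ℚ × AltMatching α) → Combination n
    toCombination = map (λ (μ , M , _) → μ , χ M)

    toCombination-supported : (cs : List (ℚ × AltMatching α)) → All (λ p → 0ℚ ≤ proj₁ p) cs →
      Supported (ShardVertex α) (toCombination cs)
    toCombination-supported [] [] = []
    toCombination-supported ((μ , M , alt) ∷ cs) (0≤μ ∷ hs) = (0≤μ , χ-shardVertex α M alt) ∷ toCombination-supported cs hs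

    fromCombination : (cs : Combination n) → Supported (ShardVertex α) cs →
      Σ (List (ℚ × AltMatching α)) λ ms → All (λ p → 0ℚ ≤ proj₁ p) ms × sumList proj₁ ms ≡ weight cs
        × (∀ i → combine cs i ≡ sumList (λ p → proj₁ p * χ (proj₁ (proj₂ p)) i) ms)
    fromCombination [] [] = [] , [] , refl , λ _ → refl
    fromCombination ((μ , v) ∷ cs) ((0≤μ , y , feasible , v≈δy) ∷ supp) =
      let (M , alt , δy≈χM) = feasible⇒matching α y feasible
          (ms , nonNeg , weight≡ , combine≡) = fromCombination cs supp
      in (μ , M , alt) ∷ ms , 0≤μ ∷ nonNeg , cong (μ +_) weight≡ ,
         λ i → cong₂ _+_ (cong (μ *_) (trans (v≈δy i) (δy≈χM i))) (combine≡ i)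

  InSP⇔hull : ∀ x → InSP α x ⇔ ConvexHull (ShardVertex α) x
  InSP⇔hull x = mk⇔
    (λ (ms , nonNeg , w≡1 , x≈) →
      toCombination ms , toCombination-supported ms nonNeg , trans (sumList-map proj₁ _ ms) w≡1 ,
      λ i → trans (x≈ i) (sym (sumList-map _ _ ms)))
    (λ (cs , supp , w≡1 , x≈) → let (ms , nonNeg , weight≡ , combine≡) = fromCombination cs supp in
      ms , nonNeg , trans weight≡ w≡1 , λ i → trans (x≈ i) (combine≡ i))

-- Splice-closed sets of feasible vectors

Respects : ∀ {n} → (BitVec n → Set) → Set
Respects P = ∀ {y y'} → y ≗ y' → P y → P y'

≗-∷ᵛ : ∀ {n} {y : BitVec (suc n)} {b y'} → y zero ≡ b → tail y ≗ y' → y ≗ (b ∷ᵛ y')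
≗-∷ᵛ y₀≡b _ zero = y₀≡b
≗-∷ᵛ _ tail≗ (suc i) = tail≗ i

allBitVecs : ∀ n → List (BitVec n)
allBitVecs zero = (λ ()) ∷ []
allBitVecs (suc n) = map (false ∷ᵛ_) (allBitVecs n) ++ᴸ map (true ∷ᵛ_) (allBitVecs n)

allBitVecs-complete : ∀ {n} (y : BitVec n) → Any (y ≗_) (allBitVecs n)
allBitVecs-complete {zero} y = here (λ ())
allBitVecs-complete {suc n} y with y zero in y₀≡
... | false = AnyP.++⁺ˡ (AnyP.map⁺ (Any.map (≗-∷ᵛ y₀≡) (allBitVecs-complete (tail y))))
... | true = AnyP.++⁺ʳ (map (false ∷ᵛ_) (allBitVecs n)) (AnyP.map⁺ (Any.map (≗-∷ᵛ y₀≡) (allBitVecs-complete (tail y))))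

module _ {A : Set} (P : A → Set) (P? : ∀ x → Dec (P x)) (f : A → ℚ) where

  argmax-list : (xs : List A) → All (λ x → ¬ P x) xs ⊎ Σ A λ m → P m × All (λ x → P x → f x ≤ f m) xs
  argmax-list [] = inj₁ []
  argmax-list (x ∷ xs) with P? x | argmax-list xs
  ... | no ¬Px | inj₁ none = inj₁ (¬Px ∷ none)
  ... | no ¬Px | inj₂ (m , Pm , bound) = inj₂ (m , Pm , (λ Px → ⊥-elim (¬Px Px)) ∷ bound)
  ... | yes Px | inj₁ none = inj₂ (x , Px , (λ _ → ℚP.≤-refl) ∷ All.map (λ ¬Px' Px' → ⊥-elim (¬Px' Px')) none)
  ... | yes Px | inj₂ (m , Pm , bound) with f x ℚP.≤? f m
  ...   | yes fx≤fm = inj₂ (m , Pm , (λ _ → fx≤fm) ∷ bound)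
  ...   | no fx≰fm = inj₂ (x , Px , (λ _ → ℚP.≤-refl) ∷ All.map (λ h Px' → ℚP.≤-trans (h Px') fm≤fx) bound)
    where
    fm≤fx = ℚP.<⇒≤ (ℚP.≰⇒> fx≰fm)

module _ {n} (P : BitVec n → Set) (P-resp : Respects P) (P? : ∀ y → Dec (P y)) where

  argmax : (f : BitVec n → ℚ) → (∀ {y y'} → y ≗ y' → f y ≡ f y') →
    (∀ y → ¬ P y) ⊎ Σ (BitVec n) λ m → P m × (∀ y → P y → f y ≤ f m)
  argmax f f-resp with argmax-list P P? f (allBitVecs n)
  ... | inj₁ none = inj₁ λ y Py →
    let (¬Py' , y≗y') = All.lookupAny none (allBitVecs-complete y) in ¬Py' (P-resp y≗y' Py)
  ... | inj₂ (m , Pm , bound) = inj₂ (m , Pm , λ y Py →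
    let (bound' , y≗y') = All.lookupAny bound (allBitVecs-complete y) in
    subst (_≤ f m) (sym (f-resp y≗y')) (bound' (P-resp y≗y' Py)))

  search : (∀ y → ¬ P y) ⊎ Σ (BitVec n) P
  search with argmax (λ _ → 0ℚ) (λ _ → refl)
  ... | inj₁ none = inj₁ none
  ... | inj₂ (m , Pm , _) = inj₂ (m , Pm)

splice : ∀ {n} → BitVec n → BitVec n → ℕ → BitVec n
splice u v k i = if toℕ i ℕ.≤ᵇ k then u i else v i

module _ {n} (u v : BitVec n) (j : Fin n) (uj≡vj : u j ≡ v j) where

  prev-splice : ∀ i → prev false (splice u v (toℕ j)) i ≡ (if toℕ i ℕ.≤ᵇ toℕ j then prev false u i else prev false v i)
  prev-splice zero = refl
  prev-splice (suc i) with ℕP.<-cmp (toℕ i) (toℕ j)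
  ... | tri< i<j _ _ rewrite FinP.toℕ-inject₁ i | ≤ᵇ-true (ℕP.<⇒≤ i<j) | <ᵇ-true i<j = refl
  ... | tri≈ _ i≡j _ rewrite FinP.toℕ-inject₁ i | i≡j | ≤ᵇ-true (ℕP.≤-refl {toℕ j}) | <ᵇ-false (ℕP.≤-refl {toℕ j}) =
    trans (cong u i≡j') (trans uj≡vj (cong v (sym i≡j')))
    where
    i≡j' : inject₁ i ≡ j
    i≡j' = FinP.toℕ-injective (trans (FinP.toℕ-inject₁ i) i≡j)
  ... | tri> _ _ j<i rewrite FinP.toℕ-inject₁ i | ≤ᵇ-false j<i | <ᵇ-false (ℕP.<⇒≤ j<i) = refl

  splice-cases : ∀ i →
    ((splice u v (toℕ j) i ≡ u i) × (prev false (splice u v (toℕ j)) i ≡ prev false u i)) ⊎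
    ((splice u v (toℕ j) i ≡ v i) × (prev false (splice u v (toℕ j)) i ≡ prev false v i))
  splice-cases i with toℕ i ℕ.≤ᵇ toℕ j in eq
  ... | true = inj₁ (refl , trans (prev-splice i) (cong (λ t → if t then prev false u i else prev false v i) eq))
  ... | false = inj₂ (refl , trans (prev-splice i) (cong (λ t → if t then prev false u i else prev false v i) eq))

  feasible-splice : ∀ {α : Arc n} → Feasible α u → Feasible α v → Feasible α (splice u v (toℕ j))
  feasible-splice {α} feasible-u feasible-v i with splice-cases i
  ... | inj₁ (s≡u , p≡u) = trans (cong₂ (localRule α i) p≡u s≡u) (feasible-u i)
  ... | inj₂ (s≡v , p≡v) = trans (cong₂ (localRule α i) p≡v s≡v) (feasible-v i)

  δ-splice : ∀ i → δ (splice u v (toℕ j)) i ≡ (if toℕ i ℕ.≤ᵇ toℕ j then δ u i else δ v i)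
  δ-splice i = begin
      δ (splice u v (toℕ j)) i
    ≡⟨ δ-prev (splice u v (toℕ j)) i ⟩
      bit (splice u v (toℕ j) i) - bit (prev false (splice u v (toℕ j)) i)
    ≡⟨ cong (λ t → bit (splice u v (toℕ j) i) - bit t) (prev-splice i) ⟩
      bit (splice u v (toℕ j) i) - bit (if toℕ i ℕ.≤ᵇ toℕ j then prev false u i else prev false v i)
    ≡⟨ bit-if (toℕ i ℕ.≤ᵇ toℕ j) ⟩
      (if toℕ i ℕ.≤ᵇ toℕ j then bit (u i) - bit (prev false u i) else bit (v i) - bit (prev false v i))
    ≡⟨ cong₂ (λ s t → if toℕ i ℕ.≤ᵇ toℕ j then s else t) (sym (δ-prev u i)) (sym (δ-prev v i)) ⟩
      (if toℕ i ℕ.≤ᵇ toℕ j then δ u i else δ v i) ∎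
    where
    open ≡-Reasoning
    bit-if : ∀ t → bit (if t then u i else v i) - bit (if t then prev false u i else prev false v i)
      ≡ (if t then bit (u i) - bit (prev false u i) else bit (v i) - bit (prev false v i))
    bit-if true = refl
    bit-if false = refl

δ-splice-swap : ∀ {n} (u v : BitVec n) (j : Fin n) → u j ≡ v j → ∀ i →
  δ (splice u v (toℕ j)) i + δ (splice v u (toℕ j)) i ≡ δ u i + δ v i
δ-splice-swap u v j uj≡vj i rewrite δ-splice u v j uj≡vj i | δ-splice v u j (sym uj≡vj) i
  with toℕ i ℕ.≤ᵇ toℕ j
... | true = refl
... | false = ℚP.+-comm (δ v i) (δ u i)

data Constraint : Set where
  fixed : Bool → Constraint
  free : Constraint
  same : Constraint
  step : Bool → Constraint

Holds : Constraint → Bool → Bool → Set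
Holds (fixed b) p c = c ≡ b
Holds free p c = ⊤
Holds same p c = p ≡ c
Holds (step ι) p c = interiorRule ι p c ≡ true

Valid : ∀ {n} → Bool → (Fin n → Constraint) → BitVec n → Set
Valid p T y = ∀ i → Holds (T i) (prev p y i) (y i)

valid-uncons : ∀ {n} p (T : Fin (suc n) → Constraint) y →
  Valid p T y ⇔ (Holds (T zero) p (y zero) × Valid (y zero) (tail T) (tail y))
valid-uncons p T y = mk⇔
  (λ valid → valid zero , λ i → subst (λ t → Holds (T (suc i)) t (y (suc i))) (prev-suc p y i) (valid (suc i)))
  (λ { (valid₀ , valid') zero → valid₀
     ; (valid₀ , valid') (suc i) → subst (λ t → Holds (T (suc i)) t (y (suc i))) (sym (prev-suc p y i)) (valid' i) })

predecessor : ∀ {n} → Fin n → Maybe (Fin n)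
predecessor zero = nothing
predecessor (suc j) = just (inject₁ j)

predecessor-nothing : ∀ {n} {i : Fin n} → predecessor i ≡ nothing → toℕ i ≡ 0
predecessor-nothing {i = zero} _ = refl

predecessor-just : ∀ {n} {i p : Fin n} → predecessor i ≡ just p → (toℕ i ≡ suc (toℕ p)) × (∀ q y → prev q y i ≡ y p)
predecessor-just {i = suc j} refl = cong suc (sym (FinP.toℕ-inject₁ j)) , λ _ _ → refl

interiorRule-≢ : ∀ ι p c → interiorRule ι p c ≡ true → p ≢ c → (p ≡ not ι) × (c ≡ ι)
interiorRule-≢ true false true _ _ = refl , refl
interiorRule-≢ false true false _ _ = refl , refl
interiorRule-≢ true false false _ p≢c = ⊥-elim (p≢c refl)
interiorRule-≢ true true true _ p≢c = ⊥-elim (p≢c refl)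
interiorRule-≢ false false false _ p≢c = ⊥-elim (p≢c refl)
interiorRule-≢ false true true _ p≢c = ⊥-elim (p≢c refl)

bool-dichotomy : ∀ {x y : Bool} → x ≢ y → ∀ z → z ≡ x ⊎ z ≡ y
bool-dichotomy {true} {true} x≢y _ = ⊥-elim (x≢y refl)
bool-dichotomy {false} {false} x≢y _ = ⊥-elim (x≢y refl)
bool-dichotomy {true} {false} _ true = inj₁ refl
bool-dichotomy {true} {false} _ false = inj₂ refl
bool-dichotomy {false} {true} _ true = inj₂ refl
bool-dichotomy {false} {true} _ false = inj₁ refl

largest : ∀ {n} → Fin n → Σ (Fin n) λ l → ∀ (j : Fin n) → toℕ j ℕ.≤ toℕ l
largest {suc m} _ = F.fromℕ m , λ j → subst (toℕ j ℕ.≤_) (sym (FinP.toℕ-fromℕ m)) (ℕP.≤-pred (FinP.toℕ<n j))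

module SpliceClosed {n} (α : Arc n) (S : BitVec n → Set)
  (S-feasible : ∀ {y} → S y → Feasible α y) (S-resp : Respects S) (S? : ∀ y → Dec (S y))
  (y* : BitVec n) (S-y* : S y*)
  (S-splice : ∀ u v (j : Fin n) → u j ≡ v j → S u → S v → S (splice u v (toℕ j))) where

  Fixed : Fin n → Set
  Fixed i = ∀ u → S u → u i ≡ y* i

  Varies : Fin n → Set
  Varies i = Σ (BitVec n) λ w → S w × (w i ≢ y* i)

  Tied : Fin n → Fin n → Set
  Tied p i = ∀ u → S u → u p ≡ u i

  Untied : Fin n → Fin n → Set
  Untied p i = Σ (BitVec n) λ w → S w × (w p ≢ w i)

  private
    S×? : ∀ {Q : BitVec n → Set} → (∀ w → Dec (Q w)) → ∀ w → Dec (S w × Q w)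
    S×? Q? w with S? w | Q? w
    ... | yes Sw | yes Qw = yes (Sw , Qw)
    ... | no ¬Sw | _ = no (λ (Sw , _) → ¬Sw Sw)
    ... | _ | no ¬Qw = no (λ (_ , Qw) → ¬Qw Qw)

  abstract
    fixed? : ∀ i → Fixed i ⊎ Varies i
    fixed? i with search (λ w → S w × (w i ≢ y* i)) (λ y≗y' (Sy , ne) → S-resp y≗y' Sy , λ eq → ne (trans (y≗y' i) eq))
                         (S×? (λ w → ¬? (w i BoolP.≟ y* i)))
    ... | inj₂ varies = inj₂ varies
    ... | inj₁ none = inj₁ λ u Su → decidable-stable (u i BoolP.≟ y* i) (λ ne → none u (Su , ne))

    tied? : ∀ p i → Tied p i ⊎ Untied p i
    tied? p i with search (λ w → S w × (w p ≢ w i))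
                          (λ y≗y' (Sy , ne) → S-resp y≗y' Sy , λ eq → ne (trans (y≗y' p) (trans eq (sym (y≗y' i)))))
                          (S×? (λ w → ¬? (w p BoolP.≟ w i)))
    ... | inj₂ untied = inj₂ untied
    ... | inj₁ none = inj₁ λ u Su → decidable-stable (u p BoolP.≟ u i) (λ ne → none u (Su , ne))

  constraintAfter : ∀ i p → Fixed p ⊎ Varies p → Tied p i ⊎ Untied p i → Constraint
  constraintAfter i p (inj₁ _) _ = free
  constraintAfter i p (inj₂ _) (inj₁ _) = same
  constraintAfter i p (inj₂ _) (inj₂ _) = step (inA α i)

  constraintAt : ∀ i → Maybe (Fin n) → Constraint
  constraintAt i nothing = free
  constraintAt i (just p) = constraintAfter i p (fixed? p) (tied? p i)

  constraintOf : ∀ i → Fixed i ⊎ Varies i → Constraint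
  constraintOf i (inj₁ _) = fixed (y* i)
  constraintOf i (inj₂ _) = constraintAt i (predecessor i)

  constraint : Fin n → Constraint
  constraint i = constraintOf i (fixed? i)

  data ConstraintSpec (i : Fin n) : Constraint → Set where
    fixed-spec : Fixed i → ConstraintSpec i (fixed (y* i))
    first-spec : Varies i → predecessor i ≡ nothing → ConstraintSpec i free
    afterFixed-spec : Varies i → ∀ p → predecessor i ≡ just p → Fixed p → ConstraintSpec i free
    same-spec : Varies i → ∀ p → predecessor i ≡ just p → Varies p → Tied p i → ConstraintSpec i same
    step-spec : Varies i → ∀ p → predecessor i ≡ just p → Varies p → Untied p i → ConstraintSpec i (step (inA α i))

  constraint-spec : ∀ i → ConstraintSpec i (constraint i)
  constraint-spec i with fixed? i
  ... | inj₁ fixedᵢ = fixed-spec fixedᵢ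
  ... | inj₂ variesᵢ with predecessor i in pred≡
  ...   | nothing = first-spec variesᵢ pred≡
  ...   | just p with fixed? p | tied? p i
  ...     | inj₁ fixedₚ | _ = afterFixed-spec variesᵢ p pred≡ fixedₚ
  ...     | inj₂ variesₚ | inj₁ tied = same-spec variesᵢ p pred≡ variesₚ tied
  ...     | inj₂ variesₚ | inj₂ untied = step-spec variesᵢ p pred≡ variesₚ untied

  LocallyValid : BitVec n → Set
  LocallyValid = Valid false constraint

  varies-support : ∀ i → Varies i → (toℕ (a α) ℕ.≤ toℕ i) × (toℕ i ℕ.< toℕ (b α))
  varies-support i (w , Sw , wi≢) =
    ℕP.≮⇒≥ (λ i<a → wi≢ (trans (feasible-before α w (S-feasible Sw) i i<a) (sym (feasible-before α y* (S-feasible S-y*) i i<a)))) ,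
    ℕP.≰⇒> (λ b≤i → wi≢ (trans (feasible-after α w (S-feasible Sw) i b≤i) (sym (feasible-after α y* (S-feasible S-y*) i b≤i))))

  varies-interior : ∀ {i p} → predecessor i ≡ just p → Varies i → Varies p → Interior α i
  varies-interior {i} {p} pred≡ variesᵢ variesₚ =
    subst (toℕ (a α) ℕ.<_) (sym (proj₁ (predecessor-just pred≡))) (ℕ.s≤s (proj₁ (varies-support p variesₚ))) ,
    proj₂ (varies-support i variesᵢ)

  S⇒locallyValid : ∀ y → S y → LocallyValid y
  S⇒locallyValid y Sy i with constraint i | constraint-spec i
  ... | _ | fixed-spec fixedᵢ = fixedᵢ y Sy
  ... | _ | first-spec _ _ = tt
  ... | _ | afterFixed-spec _ _ _ _ = tt
  ... | _ | same-spec _ p pred≡ _ tied = trans (proj₂ (predecessor-just pred≡) false y) (tied y Sy)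
  ... | _ | step-spec variesᵢ p pred≡ variesₚ _ = feasible-interior α y (S-feasible Sy) i (varies-interior pred≡ variesᵢ variesₚ)

  varies-any : ∀ i → Varies i → ∀ c → Σ (BitVec n) λ u → S u × (u i ≡ c)
  varies-any i (w , Sw , wi≢) c with bool-dichotomy (λ eq → wi≢ (sym eq)) c
  ... | inj₁ c≡y*ᵢ = y* , S-y* , sym c≡y*ᵢ
  ... | inj₂ c≡wᵢ = w , Sw , sym c≡wᵢ

  S-interiorRule : ∀ {i p} → predecessor i ≡ just p → Varies i → Varies p →
    ∀ v → S v → interiorRule (inA α i) (v p) (v i) ≡ true
  S-interiorRule {i} pred≡ variesᵢ variesₚ v Sv =
    subst (λ t → interiorRule (inA α i) t (v i) ≡ true) (proj₂ (predecessor-just pred≡) false v)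
      (feasible-interior α v (S-feasible Sv) i (varies-interior pred≡ variesᵢ variesₚ))

  -- Across an untied edge every pair of values allowed by the interior rule is realised in S:
  -- a change of value can only be the one the rule permits, so a witness of untiedness realises it.
  untied-realize : ∀ {i p} → predecessor i ≡ just p → Varies i → Varies p → Untied p i →
    ∀ {c₁ c₂} → interiorRule (inA α i) c₁ c₂ ≡ true →
    (Σ (BitVec n) λ u → S u × u p ≡ c₁) → (Σ (BitVec n) λ v → S v × v i ≡ c₂) →
    Σ (BitVec n) λ v → S v × (v p ≡ c₁) × (v i ≡ c₂)
  untied-realize {i} {p} pred≡ variesᵢ variesₚ (w , Sw , wₚ≢wᵢ) {c₁} {c₂} rule (u , Su , uₚ≡c₁) (v , Sv , vᵢ≡c₂)
    with c₁ BoolP.≟ c₂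
  ... | no c₁≢c₂ =
    let (c₁≡ , c₂≡) = interiorRule-≢ ι c₁ c₂ rule c₁≢c₂
        (wₚ≡ , wᵢ≡) = interiorRule-≢ ι (w p) (w i) (rule-in-S w Sw) wₚ≢wᵢ
    in w , Sw , trans wₚ≡ (sym c₁≡) , trans wᵢ≡ (sym c₂≡)
    where
    ι = inA α i
    rule-in-S = S-interiorRule pred≡ variesᵢ variesₚ
  ... | yes c₁≡c₂ with u i BoolP.≟ c₂ | v p BoolP.≟ c₁
  ...   | yes uᵢ≡c₂ | _ = u , Su , uₚ≡c₁ , uᵢ≡c₂
  ...   | no _ | yes vₚ≡c₁ = v , Sv , vₚ≡c₁ , vᵢ≡c₂
  ...   | no uᵢ≢c₂ | no vₚ≢c₁ = ⊥-elim (BoolP.not-¬ refl (trans (sym vᵢ≡) (trans vᵢ≡c₂ (trans (sym c₁≡c₂) (trans (sym uₚ≡c₁) uₚ≡not)))))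
    where
    ι = inA α i
    rule-in-S = S-interiorRule pred≡ variesᵢ variesₚ
    uₚ≡not : u p ≡ not ι
    uₚ≡not = proj₁ (interiorRule-≢ ι (u p) (u i) (rule-in-S u Su) (λ eq → uᵢ≢c₂ (trans (sym eq) (trans uₚ≡c₁ c₁≡c₂))))
    vᵢ≡ : v i ≡ ι
    vᵢ≡ = proj₂ (interiorRule-≢ ι (v p) (v i) (rule-in-S v Sv) (λ eq → vₚ≢c₁ (trans eq (trans vᵢ≡c₂ (sym c₁≡c₂)))))

  module _ (y : BitVec n) (valid : LocallyValid y) where

    realize-at : ∀ i → Σ (BitVec n) λ u → S u × (u i ≡ y i)
    realize-at i with constraint i | constraint-spec i | valid i
    ... | _ | fixed-spec _ | yᵢ≡ = y* , S-y* , sym yᵢ≡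
    ... | _ | first-spec variesᵢ _ | _ = varies-any i variesᵢ (y i)
    ... | _ | afterFixed-spec variesᵢ _ _ _ | _ = varies-any i variesᵢ (y i)
    ... | _ | same-spec variesᵢ _ _ _ _ | _ = varies-any i variesᵢ (y i)
    ... | _ | step-spec variesᵢ _ _ _ _ | _ = varies-any i variesᵢ (y i)

    valid-fixed : ∀ i → Fixed i → y i ≡ y* i
    valid-fixed i fixedᵢ = let (u , Su , uᵢ≡) = realize-at i in trans (sym uᵢ≡) (fixedᵢ u Su)

    realize-edge : ∀ i p → predecessor i ≡ just p → Σ (BitVec n) λ v → S v × (v p ≡ y p) × (v i ≡ y i)
    realize-edge i p pred≡ with constraint i | constraint-spec i | valid i
    ... | _ | fixed-spec fixedᵢ | yᵢ≡ =
      let (u , Su , uₚ≡) = realize-at p in u , Su , uₚ≡ , trans (fixedᵢ u Su) (sym yᵢ≡)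
    ... | _ | first-spec _ pred≡nothing | _ with trans (sym pred≡) pred≡nothing
    ...   | ()
    realize-edge i p pred≡ | _ | afterFixed-spec _ p' pred≡' fixedₚ | _ with trans (sym pred≡) pred≡'
    ... | refl = let (u , Su , uᵢ≡) = realize-at i in u , Su , trans (fixedₚ u Su) (sym (valid-fixed p fixedₚ)) , uᵢ≡
    realize-edge i p pred≡ | _ | same-spec _ p' pred≡' _ tied | yₚ≡yᵢ with trans (sym pred≡) pred≡'
    ... | refl = let (u , Su , uᵢ≡) = realize-at i in
      u , Su , trans (tied u Su) (trans uᵢ≡ (sym (trans (sym (proj₂ (predecessor-just pred≡) false y)) yₚ≡yᵢ))) , uᵢ≡
    realize-edge i p pred≡ | _ | step-spec variesᵢ p' pred≡' variesₚ untied | rule with trans (sym pred≡) pred≡'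
    ... | refl = untied-realize pred≡ variesᵢ variesₚ untied
                   (subst (λ t → interiorRule (inA α i) t (y i) ≡ true) (proj₂ (predecessor-just pred≡) false y) rule)
                   (realize-at p) (realize-at i)

    realize-prefix : ∀ k (j : Fin n) → toℕ j ≡ k → Σ (BitVec n) λ u → S u × (∀ i → toℕ i ℕ.≤ k → u i ≡ y i)
    realize-prefix zero j j≡0 = let (u , Su , uⱼ≡) = realize-at j in u , Su , λ i i≤0 →
      subst (λ t → u t ≡ y t) (FinP.toℕ-injective (trans j≡0 (sym (ℕP.n≤0⇒n≡0 i≤0)))) uⱼ≡
    realize-prefix (suc k) j j≡ with predecessor j in pred≡
    ... | nothing with trans (sym (predecessor-nothing pred≡)) j≡
    ...   | ()
    realize-prefix (suc k) j j≡ | just p = splice u v k , S-spliced , agrees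
      where
      p≡k : toℕ p ≡ k
      p≡k = ℕP.suc-injective (trans (sym (proj₁ (predecessor-just pred≡))) j≡)
      u = proj₁ (realize-prefix k p p≡k)
      Su = proj₁ (proj₂ (realize-prefix k p p≡k))
      u≡y = proj₂ (proj₂ (realize-prefix k p p≡k))
      v = proj₁ (realize-edge j p pred≡)
      Sv = proj₁ (proj₂ (realize-edge j p pred≡))
      vₚ≡ = proj₁ (proj₂ (proj₂ (realize-edge j p pred≡)))
      vⱼ≡ = proj₂ (proj₂ (proj₂ (realize-edge j p pred≡)))
      S-spliced : S (splice u v k)
      S-spliced = subst (λ t → S (splice u v t)) p≡k (S-splice u v p (trans (u≡y p (ℕP.≤-reflexive p≡k)) (sym vₚ≡)) Su Sv)
      agrees : ∀ i → toℕ i ℕ.≤ suc k → splice u v k i ≡ y i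
      agrees i i≤1+k with toℕ i ℕ.≤ᵇ k in eq
      ... | true = u≡y i (≤ᵇ-true⁻¹ eq)
      ... | false = subst (λ t → v t ≡ y t) (sym i≡j) vⱼ≡
        where
        i≡j : i ≡ j
        i≡j = FinP.toℕ-injective (trans (ℕP.≤-antisym i≤1+k (≤ᵇ-false⁻¹ eq)) (sym j≡))

    locallyValid⇒S : S y
    locallyValid⇒S = let (l , l-largest) = largest (a α)
                         (u , Su , u≡y) = realize-prefix (toℕ l) l refl
                     in S-resp (λ i → u≡y i (l-largest i)) Su

-- The face of SP(α) maximising c

module _ {m} {V : Point m → Set} (c : Point m) (B : ℚ) where

  private
    sumList-weights : ∀ (cs : Combination m) → weight cs ≡ 1ℚ → sumList (λ p → proj₁ p * B) cs ≡ B
    sumList-weights cs w≡1 = trans (sumList-*ʳ B proj₁ cs) (trans (cong (_* B) w≡1) (ℚP.*-identityˡ B))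

    dot-hull : ∀ {x} (cs : Combination m) → x ≈ₚ combine cs → dot c x ≡ sumList (λ p → proj₁ p * dot c (proj₂ p)) cs
    dot-hull cs x≈ = trans (dot-cong c x≈) (dot-combine c cs)

  hull-≤ : (∀ v → V v → dot c v ≤ B) → ∀ x → ConvexHull V x → dot c x ≤ B
  hull-≤ V≤B x (cs , supp , w≡1 , x≈) =
    subst₂ _≤_ (sym (dot-hull cs x≈)) (sumList-weights cs w≡1) (sumList-mono _ _ cs (All.map bound supp))
    where
    bound : ∀ {p} → (0ℚ ≤ proj₁ p) × V (proj₂ p) → proj₁ p * dot c (proj₂ p) ≤ proj₁ p * B
    bound (0≤μ , Vv) = *-monoˡ-≤ 0≤μ (V≤B _ Vv)

  hull-≥ : (∀ v → V v → B ≤ dot c v) → ∀ x → ConvexHull V x → B ≤ dot c x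
  hull-≥ B≤V x (cs , supp , w≡1 , x≈) =
    subst₂ _≤_ (sumList-weights cs w≡1) (sym (dot-hull cs x≈)) (sumList-mono _ _ cs (All.map bound supp))
    where
    bound : ∀ {p} → (0ℚ ≤ proj₁ p) × V (proj₂ p) → proj₁ p * B ≤ proj₁ p * dot c (proj₂ p)
    bound (0≤μ , Vv) = *-monoˡ-≤ 0≤μ (B≤V _ Vv)

  -- Vertices of weight zero are dropped from the combination.
  hull-face : (∀ v → V v → dot c v ≤ B) → ∀ x → ConvexHull V x → B ≤ dot c x →
    ConvexHull (λ v → V v × B ≤ dot c v) x
  hull-face V≤B x (cs , supp , w≡1 , x≈) B≤cx =
    let (cs' , supp' , weight≡ , combine≈) = keepMaximal cs supp slacks≡0 in
    cs' , supp' , trans weight≡ w≡1 , λ i → trans (x≈ i) (sym (combine≈ i))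
    where
    slack : ℚ × Point m → ℚ
    slack p = proj₁ p * (B - dot c (proj₂ p))
    slack-nonNeg : ∀ {p} → (0ℚ ≤ proj₁ p) × V (proj₂ p) → 0ℚ ≤ slack p
    slack-nonNeg (0≤μ , Vv) = 0≤* 0≤μ (p≤q⇒0≤q-p (V≤B _ Vv))
    slacks≡ : sumList slack cs ≡ B - dot c x
    slacks≡ = begin
        sumList slack cs
      ≡⟨ sumList-cong cs (λ p → trans (ℚP.*-distribˡ-+ (proj₁ p) B _) (cong (proj₁ p * B +_) (sym (ℚP.neg-distribʳ-* (proj₁ p) _)))) ⟩
        sumList (λ p → proj₁ p * B + - (proj₁ p * dot c (proj₂ p))) cs
      ≡⟨ sumList-+ _ _ cs ⟩
        sumList (λ p → proj₁ p * B) cs + sumList (λ p → - (proj₁ p * dot c (proj₂ p))) cs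
      ≡⟨ cong₂ _+_ (sumList-weights cs w≡1) (trans (sumList-neg _ cs) (cong -_ (sym (dot-hull cs x≈)))) ⟩
        B - dot c x ∎
      where open ≡-Reasoning
    slacks≡0 : All (λ p → slack p ≡ 0ℚ) cs
    slacks≡0 = sumList-nonNeg-≤0 slack cs (All.map slack-nonNeg supp) (subst (_≤ 0ℚ) (sym slacks≡) (p≤q⇒p-q≤0 B≤cx))
    keepMaximal : (cs : Combination m) → Supported V cs → All (λ p → slack p ≡ 0ℚ) cs →
      Σ (Combination m) λ cs' → Supported (λ v → V v × B ≤ dot c v) cs' × weight cs' ≡ weight cs × combine cs' ≈ₚ combine cs
    keepMaximal [] [] [] = [] , [] , refl , λ _ → refl
    keepMaximal ((μ , v) ∷ cs) ((0≤μ , Vv) ∷ supp) (slack≡0 ∷ slacks) with B ℚP.≤? dot c v | keepMaximal cs supp slacks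
    ... | yes B≤cv | (cs' , supp' , weight≡ , combine≈) =
      (μ , v) ∷ cs' , (0≤μ , Vv , B≤cv) ∷ supp' , cong (μ +_) weight≡ , λ i → cong (μ * v i +_) (combine≈ i)
    ... | no B≰cv | (cs' , supp' , weight≡ , combine≈) =
      cs' , supp' , trans weight≡ (sym (trans (cong (_+ weight cs) μ≡0) (ℚP.+-identityˡ _))) ,
      λ i → trans (combine≈ i) (sym (trans (cong (λ t → t * v i + combine cs i) μ≡0) (trans (cong (_+ combine cs i) (ℚP.*-zeroˡ (v i))) (ℚP.+-identityˡ _))))
      where
      μ≡0 : μ ≡ 0ℚ
      μ≡0 = *≡0⇒≡0 μ (B - dot c v) slack≡0 λ B-cv≡0 → B≰cv (ℚP.≤-reflexive (trans
              (sym (solve 2 (λ s t → (s :- t) :+ t := s) refl B (dot c v))) (trans (cong (_+ dot c v) B-cv≡0) (ℚP.+-identityˡ _))))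

feasible-resp : ∀ {n} (α : Arc n) → Respects (Feasible α)
feasible-resp α {y} {y'} y≗y' feasible i =
  trans (cong₂ (localRule α i) (sym (prev-resp i)) (sym (y≗y' i))) (feasible i)
  where
  prev-resp : ∀ i → prev false y i ≡ prev false y' i
  prev-resp zero = refl
  prev-resp (suc i) = y≗y' (inject₁ i)

feasible? : ∀ {n} (α : Arc n) y → Dec (Feasible α y)
feasible? α y = FinP.all? (λ i → localRule α i (prev false y i) (y i) BoolP.≟ true)

feasible-zero : ∀ {n} (α : Arc n) → Feasible α (λ _ → false)
feasible-zero α = feasible-intro α _ (λ _ _ → refl) (λ _ _ → refl) interior
  where
  rule-ff : ∀ ι → interiorRule ι false false ≡ true
  rule-ff true = refl
  rule-ff false = refl
  interior : ∀ i → Interior α i → interiorRule (inA α i) (prev false (λ _ → false) i) false ≡ true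
  interior zero _ = rule-ff (inA α zero)
  interior (suc i) _ = rule-ff (inA α (suc i))

module Optimum {n} (α : Arc n) (c : Point n) where

  score : BitVec n → ℚ
  score y = dot c (δ y)

  score-resp : ∀ {y y'} → y ≗ y' → score y ≡ score y'
  score-resp y≗y' = dot-cong c (affineMap-cong affineMap-diff (λ i → cong bit (y≗y' i)))

  abstract
    optimum : Σ (BitVec n) λ y → Feasible α y × (∀ y' → Feasible α y' → score y' ≤ score y)
    optimum with argmax (Feasible α) (feasible-resp α) (feasible? α) score score-resp
    ... | inj₁ none = ⊥-elim (none _ (feasible-zero α))
    ... | inj₂ max = max

  y* : BitVec n
  y* = proj₁ optimum

  y*-maximal : ∀ y → Feasible α y → score y ≤ score y*
  y*-maximal = proj₂ (proj₂ optimum)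

  Optimal : BitVec n → Set
  Optimal y = Feasible α y × (score y* ≤ score y)

  optimal-y* : Optimal y*
  optimal-y* = proj₁ (proj₂ optimum) , ℚP.≤-refl

  optimal-resp : Respects Optimal
  optimal-resp y≗y' (feasible , ≥score) = feasible-resp α y≗y' feasible , subst (score y* ≤_) (score-resp y≗y') ≥score

  optimal? : ∀ y → Dec (Optimal y)
  optimal? y with feasible? α y | score y* ℚP.≤? score y
  ... | yes feasible | yes ≥score = yes (feasible , ≥score)
  ... | no ¬feasible | _ = no (λ (feasible , _) → ¬feasible feasible)
  ... | _ | no ¬≥score = no (λ (_ , ≥score) → ¬≥score ≥score)

  -- The two splices have the same total score as u and v and both are feasible, so neither can
  -- fall below the maximum.
  optimal-splice : ∀ u v (j : Fin n) → u j ≡ v j → Optimal u → Optimal v → Optimal (splice u v (toℕ j))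
  optimal-splice u v j uj≡vj (feasible-u , u≥) (feasible-v , v≥) =
    feasible-splice u v j uj≡vj {α} feasible-u feasible-v ,
    ≤-of-sum scores≡ u≥ v≥ (y*-maximal _ (feasible-splice v u j (sym uj≡vj) {α} feasible-v feasible-u))
    where
    scores≡ : score (splice u v (toℕ j)) + score (splice v u (toℕ j)) ≡ score u + score v
    scores≡ = trans (sym (dot-+ʳ c _ _)) (trans (dot-cong c (δ-splice-swap u v j uj≡vj)) (dot-+ʳ c _ _))
    ≤-of-sum : ∀ {s t p q M : ℚ} → s + t ≡ p + q → M ≤ p → M ≤ q → t ≤ M → M ≤ s
    ≤-of-sum {s} {t} {p} {q} {M} s+t≡p+q M≤p M≤q t≤M =
      subst₂ _≤_ (solve 1 (λ m → m :+ (m :- m) := m) refl M) p+q-t≡s (ℚP.+-mono-≤ M≤p (ℚP.+-mono-≤ M≤q (ℚP.neg-antimono-≤ t≤M)))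
      where
      p+q-t≡s : p + (q - t) ≡ s
      p+q-t≡s = trans (solve 3 (λ p q t → p :+ (q :- t) := (p :+ q) :- t) refl p q t)
                  (trans (cong (_- t) (sym s+t≡p+q)) (solve 2 (λ s t → (s :+ t) :- t := s) refl s t))

  open SpliceClosed α Optimal proj₁ optimal-resp optimal? y* optimal-y* optimal-splice public

  OptimalVertex : Point n → Set
  OptimalVertex v = Σ (BitVec n) λ y → Optimal y × v ≈ₚ δ y

  InFace⇔hull : ∀ x → InFace α c x ⇔ ConvexHull OptimalVertex x
  InFace⇔hull x = mk⇔ face⇒hull hull⇒face
    where
    vertex≤ : ∀ v → ShardVertex α v → dot c v ≤ score y*
    vertex≤ v (y , feasible , v≈δy) = subst (_≤ score y*) (sym (dot-cong c v≈δy)) (y*-maximal y feasible)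
    face⇒hull : InFace α c x → ConvexHull OptimalVertex x
    face⇒hull (inSP , maximal) =
      hull-mono (λ v ((y , feasible , v≈δy) , y*≤) → y , (feasible , subst (score y* ≤_) (dot-cong c v≈δy) y*≤) , v≈δy) x
        (hull-face c (score y*) vertex≤ x (to (InSP⇔hull α x) inSP)
          (maximal (δ y*) (from (InSP⇔hull α (δ y*)) (singleton-hull (y* , proj₁ optimal-y* , λ _ → refl)))))
    hull⇒face : ConvexHull OptimalVertex x → InFace α c x
    hull⇒face hx =
      from (InSP⇔hull α x) (hull-mono (λ v (y , (feasible , _) , v≈δy) → y , feasible , v≈δy) x hx) ,
      λ x' inSP' → ℚP.≤-trans (hull-≤ c (score y*) vertex≤ x' (to (InSP⇔hull α x') inSP'))
                             (hull-≥ c (score y*) (λ v (y , (_ , y*≤) , v≈δy) → subst (score y* ≤_) (sym (dot-cong c v≈δy)) y*≤) x hx)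

-- Layouts and chain arcs

data Layout : ℕ → Set
data Block : ℕ → Set

data Layout where
  done : Layout 0
  fix : ∀ {n} → Bool → Layout n → Layout (suc n)
  start : ∀ {n} → Block n → Layout (suc n)

data Block where
  copy : ∀ {n} → Block n → Block (suc n)
  relate : ∀ {n} → Bool → Block n → Block (suc n)
  close : ∀ {n} → Layout n → Block n

InLayout : ∀ {n} → Layout n → BitVec n → Set
InBlock : ∀ {n} → Block n → Bool → BitVec n → Set
InLayout done y = ⊤
InLayout (fix b L) y = (y zero ≡ b) × InLayout L (tail y)
InLayout (start B) y = InBlock B (y zero) (tail y)
InBlock (copy B) p y = (p ≡ y zero) × InBlock B (y zero) (tail y)
InBlock (relate ι B) p y = (interiorRule ι p (y zero) ≡ true) × InBlock B (y zero) (tail y)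
InBlock (close L) p y = InLayout L y

inLayout-resp : ∀ {n} (L : Layout n) → Respects (InLayout L)
inBlock-resp : ∀ {n} (B : Block n) p → Respects (InBlock B p)
inLayout-resp done _ _ = tt
inLayout-resp (fix b L) y≗y' (y₀≡b , inL) = trans (sym (y≗y' zero)) y₀≡b , inLayout-resp L (λ i → y≗y' (suc i)) inL
inLayout-resp (start B) {y} {y'} y≗y' inB =
  subst (λ t → InBlock B t (tail y')) (y≗y' zero) (inBlock-resp B (y zero) (λ i → y≗y' (suc i)) inB)
inBlock-resp (copy B) p {y} {y'} y≗y' (p≡y₀ , inB) =
  trans p≡y₀ (y≗y' zero) , subst (λ t → InBlock B t (tail y')) (y≗y' zero) (inBlock-resp B (y zero) (λ i → y≗y' (suc i)) inB)
inBlock-resp (relate ι B) p {y} {y'} y≗y' (rule , inB) =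
  subst (λ t → interiorRule ι p t ≡ true) (y≗y' zero) rule ,
  subst (λ t → InBlock B t (tail y')) (y≗y' zero) (inBlock-resp B (y zero) (λ i → y≗y' (suc i)) inB)
inBlock-resp (close L) p y≗y' inL = inLayout-resp L y≗y' inL

layoutOf : ∀ {n} → (Fin n → Constraint) → Layout n
blockOf : ∀ {n} → (Fin n → Constraint) → Block n
layoutStep : ∀ {n} → Constraint → (Fin n → Constraint) → Layout (suc n)
blockStep : ∀ {n} → Constraint → (Fin n → Constraint) → Block (suc n)
layoutOf {zero} T = done
layoutOf {suc n} T = layoutStep (T zero) (tail T)
blockOf {zero} T = close done
blockOf {suc n} T = blockStep (T zero) (tail T)
layoutStep (fixed b) T' = fix b (layoutOf T')
layoutStep free T' = start (blockOf T')
layoutStep same T' = start (blockOf T')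
layoutStep (step _) T' = start (blockOf T')
blockStep (fixed b) T' = close (fix b (layoutOf T'))
blockStep free T' = close (start (blockOf T'))
blockStep same T' = copy (blockOf T')
blockStep (step ι) T' = relate ι (blockOf T')

unfixed : Constraint → Bool
unfixed (fixed _) = false
unfixed _ = true

-- A copy or a relation is only meaningful after an unfixed position.
Admissible : Bool → Constraint → Set
Admissible q same = q ≡ true
Admissible q (step _) = q ≡ true
Admissible q _ = ⊤

WellFormed : ∀ {n} → Bool → (Fin n → Constraint) → Set
WellFormed q T = ∀ i → Admissible (prev q (λ j → unfixed (T j)) i) (T i)

wellFormed-uncons : ∀ {n} q (T : Fin (suc n) → Constraint) → WellFormed q T →
  Admissible q (T zero) × WellFormed (unfixed (T zero)) (tail T)
wellFormed-uncons q T wf = wf zero , λ i → subst (λ t → Admissible t (T (suc i))) (prev-suc q (λ j → unfixed (T j)) i) (wf (suc i))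

layoutOf-correct : ∀ {n} (T : Fin n → Constraint) → WellFormed false T → ∀ p y → InLayout (layoutOf T) y ⇔ Valid p T y
blockOf-correct : ∀ {n} (T : Fin n → Constraint) → WellFormed true T → ∀ p y → InBlock (blockOf T) p y ⇔ Valid p T y
layoutStep-correct : ∀ {n} t (T' : Fin n → Constraint) → Admissible false t → WellFormed (unfixed t) T' → ∀ p y →
  InLayout (layoutStep t T') y ⇔ (Holds t p (y zero) × Valid (y zero) T' (tail y))
blockStep-correct : ∀ {n} t (T' : Fin n → Constraint) → WellFormed (unfixed t) T' → ∀ p y →
  InBlock (blockStep t T') p y ⇔ (Holds t p (y zero) × Valid (y zero) T' (tail y))

layoutOf-correct {zero} T _ p y = mk⇔ (λ _ ()) (λ _ → tt)
layoutOf-correct {suc n} T wf p y =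
  let (adm , wf') = wellFormed-uncons false T wf in
  ⇔.trans (layoutStep-correct (T zero) (tail T) adm wf' p y) (⇔.sym (valid-uncons p T y))
blockOf-correct {zero} T _ p y = mk⇔ (λ _ ()) (λ _ → tt)
blockOf-correct {suc n} T wf p y =
  ⇔.trans (blockStep-correct (T zero) (tail T) (proj₂ (wellFormed-uncons true T wf)) p y) (⇔.sym (valid-uncons p T y))

layoutStep-correct (fixed b) T' _ wf' p y = ⇔.refl ×-⇔ layoutOf-correct T' wf' (y zero) (tail y)
layoutStep-correct free T' _ wf' p y =
  let inBlock⇔ = blockOf-correct T' wf' (y zero) (tail y) in mk⇔ (λ h → tt , to inBlock⇔ h) (λ (_ , h) → from inBlock⇔ h)
layoutStep-correct same T' () wf' p y
layoutStep-correct (step _) T' () wf' p y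
blockStep-correct (fixed b) T' wf' p y = layoutStep-correct (fixed b) T' tt wf' p y
blockStep-correct free T' wf' p y = layoutStep-correct free T' tt wf' p y
blockStep-correct same T' wf' p y = ⇔.refl ×-⇔ blockOf-correct T' wf' (y zero) (tail y)
blockStep-correct (step ι) T' wf' p y = ⇔.refl ×-⇔ blockOf-correct T' wf' (y zero) (tail y)

bitAt : List Bool → ℕ → Bool
bitAt [] _ = false
bitAt (b ∷ bs) zero = b
bitAt (b ∷ bs) (suc k) = bitAt bs k

-- inA of a chain arc; its values at the two endpoints are irrelevant.
chainInA : ∀ {m} → List Bool → Fin m → Bool
chainInA bs zero = false
chainInA bs (suc i) = bitAt bs (toℕ i)

chainArc : (bs : List Bool) → Arc (suc (suc (length bs)))
chainArc bs = arc zero (F.fromℕ (suc (length bs))) (ℕ.s≤s ℕ.z≤n) (chainInA bs)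

ChainHolds : (bs : List Bool) → Bool → BitVec (suc (length bs)) → Set
ChainHolds [] p z = z zero ≡ false
ChainHolds (ι ∷ bs) p z = (interiorRule ι p (z zero) ≡ true) × ChainHolds bs (z zero) (tail z)

chainHolds-resp : ∀ bs p → Respects (ChainHolds bs p)
chainHolds-resp [] p z≗z' z₀≡ = trans (sym (z≗z' zero)) z₀≡
chainHolds-resp (ι ∷ bs) p {z} {z'} z≗z' (rule , holds) =
  subst (λ t → interiorRule ι p t ≡ true) (z≗z' zero) rule ,
  subst (λ t → ChainHolds bs t (tail z')) (z≗z' zero) (chainHolds-resp bs (z zero) (λ i → z≗z' (suc i)) holds)

b-chainArc : ∀ bs → toℕ (b (chainArc bs)) ≡ suc (length bs)
b-chainArc bs = FinP.toℕ-fromℕ (suc (length bs))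

feasible-chainArc-∷ : ∀ ι bs (v : BitVec (suc (suc (suc (length bs))))) →
  Feasible (chainArc (ι ∷ bs)) v ⇔ ((interiorRule ι (v zero) (v (suc zero)) ≡ true) × Feasible (chainArc bs) (tail v))
feasible-chainArc-∷ ι bs v = mk⇔ split join
  where
  α = chainArc (ι ∷ bs)
  α' = chainArc bs
  split : Feasible α v → (interiorRule ι (v zero) (v (suc zero)) ≡ true) × Feasible α' (tail v)
  split feasible =
    feasible-interior α v feasible (suc zero) (ℕ.s≤s ℕ.z≤n , subst (1 ℕ.<_) (sym (b-chainArc (ι ∷ bs))) (ℕ.s≤s (ℕ.s≤s ℕ.z≤n))) ,
    feasible-intro α' (tail v) (λ _ ()) after interior
    where
    after : ∀ i → toℕ (b α') ℕ.≤ toℕ i → tail v i ≡ false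
    after i b'≤i = feasible-after α v feasible (suc i)
      (subst (ℕ._≤ suc (toℕ i)) (sym (b-chainArc (ι ∷ bs))) (ℕ.s≤s (subst (ℕ._≤ toℕ i) (b-chainArc bs) b'≤i)))
    interior : ∀ i → Interior α' i → interiorRule (inA α' i) (prev false (tail v) i) (tail v i) ≡ true
    interior zero (() , _)
    interior (suc j) (_ , j<b') = feasible-interior α v feasible (suc (suc j))
      (ℕ.s≤s ℕ.z≤n , subst (suc (suc (toℕ j)) ℕ.<_) (sym (b-chainArc (ι ∷ bs))) (ℕ.s≤s (subst (suc (toℕ j) ℕ.<_) (b-chainArc bs) j<b')))
  join : (interiorRule ι (v zero) (v (suc zero)) ≡ true) × Feasible α' (tail v) → Feasible α v
  join (rule , feasible') = feasible-intro α v (λ _ ()) after interior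
    where
    after : ∀ i → toℕ (b α) ℕ.≤ toℕ i → v i ≡ false
    after zero b≤0 with subst (ℕ._≤ 0) (b-chainArc (ι ∷ bs)) b≤0
    ... | ()
    after (suc i) b≤i = feasible-after α' (tail v) feasible' i
      (subst (ℕ._≤ toℕ i) (sym (b-chainArc bs)) (ℕP.≤-pred (subst (ℕ._≤ suc (toℕ i)) (b-chainArc (ι ∷ bs)) b≤i)))
    interior : ∀ i → Interior α i → interiorRule (inA α i) (prev false v i) (v i) ≡ true
    interior zero (() , _)
    interior (suc zero) _ = rule
    interior (suc (suc j)) (_ , j<b) = feasible-interior α' (tail v) feasible' (suc j)
      (ℕ.s≤s ℕ.z≤n , subst (suc (toℕ j) ℕ.<_) (sym (b-chainArc bs)) (ℕP.≤-pred (subst (suc (suc (toℕ j)) ℕ.<_) (b-chainArc (ι ∷ bs)) j<b)))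

feasible-chainArc : ∀ bs (v : BitVec (suc (suc (length bs)))) → Feasible (chainArc bs) v ⇔ ChainHolds bs (v zero) (tail v)
feasible-chainArc [] v = mk⇔ (λ feasible → feasible-after (chainArc []) v feasible (suc zero) ℕP.≤-refl) join
  where
  join : v (suc zero) ≡ false → Feasible (chainArc []) v
  join v₁≡false = feasible-intro (chainArc []) v (λ _ ()) after interior
    where
    after : ∀ i → toℕ (b (chainArc [])) ℕ.≤ toℕ i → v i ≡ false
    after zero ()
    after (suc zero) _ = v₁≡false
    interior : ∀ i → Interior (chainArc []) i → interiorRule (inA (chainArc []) i) (prev false v i) (v i) ≡ true
    interior zero (() , _)
    interior (suc zero) (_ , ℕ.s≤s ())
feasible-chainArc (ι ∷ bs) v = ⇔.trans (feasible-chainArc-∷ ι bs v) (⇔.refl ×-⇔ feasible-chainArc bs (tail v))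

blockSteps : ∀ {n} → Block n → List Bool
blockSteps (copy B) = blockSteps B
blockSteps (relate ι B) = ι ∷ blockSteps B
blockSteps (close L) = []

layoutArcs : ∀ {n} → Layout n → ArcList
blockArcs : ∀ {n} → Block n → ArcList
layoutArcs done = []
layoutArcs (fix b L) = layoutArcs L
layoutArcs (start B) = (_ , chainArc (blockSteps B)) ∷ blockArcs B
blockArcs (copy B) = blockArcs B
blockArcs (relate ι B) = blockArcs B
blockArcs (close L) = layoutArcs L

FeasibleProduct : (ps : ArcList) → BitVec (dimL ps) → Set
FeasibleProduct [] z = ⊤
FeasibleProduct ((m , β) ∷ ps) z = Feasible β (take m z) × FeasibleProduct ps (drop m z)

feasibleProduct-resp : ∀ ps → Respects (FeasibleProduct ps)
feasibleProduct-resp [] _ _ = tt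
feasibleProduct-resp ((m , β) ∷ ps) z≗z' (feasible , rest) =
  feasible-resp β (λ i → z≗z' (i ↑ˡ _)) feasible , feasibleProduct-resp ps (λ i → z≗z' (m ↑ʳ i)) rest

chainLength : ∀ {n} → Block n → ℕ
chainLength B = suc (length (blockSteps B))

BlockTarget : ∀ {n} (B : Block n) → Bool → BitVec (chainLength B ℕ.+ dimL (blockArcs B)) → Set
BlockTarget B p z = ChainHolds (blockSteps B) p (take (chainLength B) z) × FeasibleProduct (blockArcs B) (drop (chainLength B) z)

blockTarget-resp : ∀ {n} (B : Block n) p → Respects (BlockTarget B p)
blockTarget-resp B p z≗z' (holds , rest) =
  chainHolds-resp (blockSteps B) p (λ i → z≗z' (i ↑ˡ _)) holds , feasibleProduct-resp (blockArcs B) (λ i → z≗z' (_ ↑ʳ i)) rest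

-- previous stands for the bit before the whole input vector.
data Source (k : ℕ) : Set where
  coord : Fin k → Source k
  const : Bool → Source k
  previous : Source k

eval : ∀ {k} → Source k → BitVec k → Bool → Bool
eval (coord i) z p = z i
eval (const b) z p = b
eval previous z p = p

select : ∀ {m k} → (Fin m → Source k) → BitVec k → Bool → BitVec m
select σ z p j = eval (σ j) z p

eval-resp : ∀ {k} (s : Source k) {z z'} p → z ≗ z' → eval s z p ≡ eval s z' p
eval-resp (coord i) p z≗z' = z≗z' i
eval-resp (const b) p z≗z' = refl
eval-resp previous p z≗z' = refl

weaken : ∀ {k} → Source k → Source (suc k)
weaken (coord i) = coord (suc i)
weaken (const b) = const b
weaken previous = previous

headAsPrevious : ∀ {k} → Source k → Source (suc k)
headAsPrevious (coord i) = coord (suc i)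
headAsPrevious (const b) = const b
headAsPrevious previous = coord zero

eval-weaken : ∀ {k} (s : Source k) z p → eval (weaken s) z p ≡ eval s (tail z) p
eval-weaken (coord i) z p = refl
eval-weaken (const b) z p = refl
eval-weaken previous z p = refl

eval-headAsPrevious : ∀ {k} (s : Source k) z p → eval (headAsPrevious s) z p ≡ eval s (tail z) (z zero)
eval-headAsPrevious (coord i) z p = refl
eval-headAsPrevious (const b) z p = refl
eval-headAsPrevious previous z p = refl

record SelectionIso {n K : ℕ} (P : Bool → BitVec n → Set) (Q : Bool → BitVec K → Set) : Set where
  field
    σ : Fin K → Source n
    τ : Fin n → Source K
    σ-maps : ∀ p y → P p y → Q p (select σ y p)
    τ∘σ : ∀ p y → P p y → select τ (select σ y p) p ≗ y
    τ-maps : ∀ p z → Q p z → P p (select τ z p)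
    σ∘τ : ∀ p z → Q p z → select σ (select τ z p) p ≗ z

open SelectionIso

layoutIso : ∀ {n} (L : Layout n) → SelectionIso (λ _ → InLayout L) (λ _ → FeasibleProduct (layoutArcs L))
blockIso : ∀ {n} (B : Block n) → SelectionIso (InBlock B) (BlockTarget B)

layoutIso done = record
  { σ = λ () ; τ = λ () ; σ-maps = λ _ _ _ → tt ; τ∘σ = λ _ _ _ () ; τ-maps = λ _ _ _ → tt ; σ∘τ = λ _ _ _ () }
layoutIso (fix b L) = record { σ = σ' ; τ = τ' ; σ-maps = σ-maps' ; τ∘σ = τ∘σ' ; τ-maps = λ p z h → refl , τ-maps I p z h ; σ∘τ = σ∘τ' }
  where
  I = layoutIso L
  σ' : Fin _ → Source _
  σ' j = weaken (σ I j)
  τ' : Fin _ → Source _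
  τ' zero = const b
  τ' (suc i) = τ I i
  σ'≗ : ∀ y p → select σ' y p ≗ select (σ I) (tail y) p
  σ'≗ y p j = eval-weaken (σ I j) y p
  σ-maps' : ∀ p y → InLayout (fix b L) y → FeasibleProduct (layoutArcs L) (select σ' y p)
  σ-maps' p y (_ , inL) = feasibleProduct-resp (layoutArcs L) (λ j → sym (σ'≗ y p j)) (σ-maps I p (tail y) inL)
  τ∘σ' : ∀ p y → InLayout (fix b L) y → select τ' (select σ' y p) p ≗ y
  τ∘σ' p y (y₀≡b , inL) zero = sym y₀≡b
  τ∘σ' p y (y₀≡b , inL) (suc i) = trans (eval-resp (τ I i) p (σ'≗ y p)) (τ∘σ I p (tail y) inL i)
  σ∘τ' : ∀ p z → FeasibleProduct (layoutArcs L) z → select σ' (select τ' z p) p ≗ z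
  σ∘τ' p z h j = trans (eval-weaken (σ I j) (select τ' z p) p) (σ∘τ I p z h j)
layoutIso (start B) = record { σ = σ' ; τ = τ' ; σ-maps = σ-maps' ; τ∘σ = τ∘σ' ; τ-maps = τ-maps' ; σ∘τ = σ∘τ' }
  where
  I = blockIso B
  bs = blockSteps B
  σ' : Fin _ → Source _
  σ' zero = coord zero
  σ' (suc j) = headAsPrevious (σ I j)
  τ' : Fin _ → Source _
  τ' zero = coord zero
  τ' (suc i) = headAsPrevious (τ I i)
  σ'≗ : ∀ y p → tail (select σ' y p) ≗ select (σ I) (tail y) (y zero)
  σ'≗ y p j = eval-headAsPrevious (σ I j) y p
  τ'≗ : ∀ z p → tail (select τ' z p) ≗ select (τ I) (tail z) (z zero)
  τ'≗ z p j = eval-headAsPrevious (τ I j) z p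
  σ-maps' : ∀ p y → InLayout (start B) y → FeasibleProduct (layoutArcs (start B)) (select σ' y p)
  σ-maps' p y inB = let (holds , rest) = blockTarget-resp B (y zero) (λ j → sym (σ'≗ y p j)) (σ-maps I (y zero) (tail y) inB)
                    in from (feasible-chainArc bs _) holds , rest
  τ∘σ' : ∀ p y → InLayout (start B) y → select τ' (select σ' y p) p ≗ y
  τ∘σ' p y inB zero = refl
  τ∘σ' p y inB (suc i) =
    trans (eval-headAsPrevious (τ I i) (select σ' y p) p) (trans (eval-resp (τ I i) (y zero) (σ'≗ y p)) (τ∘σ I (y zero) (tail y) inB i))
  τ-maps' : ∀ p z → FeasibleProduct (layoutArcs (start B)) z → InLayout (start B) (select τ' z p)
  τ-maps' p z (feasible , rest) =
    inBlock-resp B (z zero) (λ i → sym (τ'≗ z p i)) (τ-maps I (z zero) (tail z) (to (feasible-chainArc bs _) feasible , rest))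
  σ∘τ' : ∀ p z → FeasibleProduct (layoutArcs (start B)) z → select σ' (select τ' z p) p ≗ z
  σ∘τ' p z _ zero = refl
  σ∘τ' p z (feasible , rest) (suc j) = trans (eval-headAsPrevious (σ I j) (select τ' z p) p)
    (trans (eval-resp (σ I j) (z zero) (τ'≗ z p)) (σ∘τ I (z zero) (tail z) (to (feasible-chainArc bs _) feasible , rest) j))
blockIso (close L) = record { σ = σ' ; τ = τ' ; σ-maps = λ p y h → refl , σ-maps I p y h ; τ∘σ = τ∘σ' ; τ-maps = τ-maps' ; σ∘τ = σ∘τ' }
  where
  I = layoutIso L
  σ' : Fin _ → Source _
  σ' zero = const false
  σ' (suc j) = σ I j
  τ' : Fin _ → Source _
  τ' i = weaken (τ I i)
  τ'≗ : ∀ z p → select τ' z p ≗ select (τ I) (tail z) p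
  τ'≗ z p i = eval-weaken (τ I i) z p
  τ∘σ' : ∀ p y → InLayout L y → select τ' (select σ' y p) p ≗ y
  τ∘σ' p y inL i = trans (eval-weaken (τ I i) (select σ' y p) p) (τ∘σ I p y inL i)
  τ-maps' : ∀ p z → BlockTarget (close L) p z → InLayout L (select τ' z p)
  τ-maps' p z (_ , rest) = inLayout-resp L (λ i → sym (τ'≗ z p i)) (τ-maps I p (tail z) rest)
  σ∘τ' : ∀ p z → BlockTarget (close L) p z → select σ' (select τ' z p) p ≗ z
  σ∘τ' p z (z₀≡false , rest) zero = sym z₀≡false
  σ∘τ' p z (_ , rest) (suc j) = trans (eval-resp (σ I j) p (τ'≗ z p)) (σ∘τ I p (tail z) rest j)
blockIso (copy B) = record { σ = σ' ; τ = τ' ; σ-maps = σ-maps' ; τ∘σ = τ∘σ' ; τ-maps = λ p z h → refl , τ-maps I p z h ; σ∘τ = σ∘τ' }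
  where
  I = blockIso B
  σ' : Fin _ → Source _
  σ' j = weaken (σ I j)
  τ' : Fin _ → Source _
  τ' zero = previous
  τ' (suc i) = τ I i
  σ'≗ : ∀ y p → select σ' y p ≗ select (σ I) (tail y) p
  σ'≗ y p j = eval-weaken (σ I j) y p
  σ-maps' : ∀ p y → InBlock (copy B) p y → BlockTarget (copy B) p (select σ' y p)
  σ-maps' p y (p≡y₀ , inB) =
    blockTarget-resp B p (λ j → sym (σ'≗ y p j)) (σ-maps I p (tail y) (subst (λ t → InBlock B t (tail y)) (sym p≡y₀) inB))
  τ∘σ' : ∀ p y → InBlock (copy B) p y → select τ' (select σ' y p) p ≗ y
  τ∘σ' p y (p≡y₀ , inB) zero = p≡y₀
  τ∘σ' p y (p≡y₀ , inB) (suc i) =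
    trans (eval-resp (τ I i) p (σ'≗ y p)) (τ∘σ I p (tail y) (subst (λ t → InBlock B t (tail y)) (sym p≡y₀) inB) i)
  σ∘τ' : ∀ p z → BlockTarget (copy B) p z → select σ' (select τ' z p) p ≗ z
  σ∘τ' p z h j = trans (eval-weaken (σ I j) (select τ' z p) p) (σ∘τ I p z h j)
blockIso (relate ι B) = record { σ = σ' ; τ = τ' ; σ-maps = σ-maps' ; τ∘σ = τ∘σ' ; τ-maps = τ-maps' ; σ∘τ = σ∘τ' }
  where
  I = blockIso B
  σ' : Fin _ → Source _
  σ' zero = coord zero
  σ' (suc j) = headAsPrevious (σ I j)
  τ' : Fin _ → Source _
  τ' zero = coord zero
  τ' (suc i) = headAsPrevious (τ I i)
  σ'≗ : ∀ y p → tail (select σ' y p) ≗ select (σ I) (tail y) (y zero)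
  σ'≗ y p j = eval-headAsPrevious (σ I j) y p
  τ'≗ : ∀ z p → tail (select τ' z p) ≗ select (τ I) (tail z) (z zero)
  τ'≗ z p j = eval-headAsPrevious (τ I j) z p
  σ-maps' : ∀ p y → InBlock (relate ι B) p y → BlockTarget (relate ι B) p (select σ' y p)
  σ-maps' p y (rule , inB) = let (holds , rest) = blockTarget-resp B (y zero) (λ j → sym (σ'≗ y p j)) (σ-maps I (y zero) (tail y) inB)
                             in (rule , holds) , rest
  τ∘σ' : ∀ p y → InBlock (relate ι B) p y → select τ' (select σ' y p) p ≗ y
  τ∘σ' p y _ zero = refl
  τ∘σ' p y (_ , inB) (suc i) =
    trans (eval-headAsPrevious (τ I i) (select σ' y p) p) (trans (eval-resp (τ I i) (y zero) (σ'≗ y p)) (τ∘σ I (y zero) (tail y) inB i))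
  τ-maps' : ∀ p z → BlockTarget (relate ι B) p z → InBlock (relate ι B) p (select τ' z p)
  τ-maps' p z ((rule , holds) , rest) = rule , inBlock-resp B (z zero) (λ i → sym (τ'≗ z p i)) (τ-maps I (z zero) (tail z) (holds , rest))
  σ∘τ' : ∀ p z → BlockTarget (relate ι B) p z → select σ' (select τ' z p) p ≗ z
  σ∘τ' p z _ zero = refl
  σ∘τ' p z ((_ , holds) , rest) (suc j) = trans (eval-headAsPrevious (σ I j) (select τ' z p) p)
    (trans (eval-resp (σ I j) (z zero) (τ'≗ z p)) (σ∘τ I (z zero) (tail z) (holds , rest) j))

-- The face as a product of shard polytopes

blockDiff : (ps : ArcList) → Point (dimL ps) → Point (dimL ps)
blockDiff [] z = z
blockDiff ((m , _) ∷ ps) z = diff (take m z) ++ blockDiff ps (drop m z)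

blockPrefixSum : (ps : ArcList) → Point (dimL ps) → Point (dimL ps)
blockPrefixSum [] z = z
blockPrefixSum ((m , _) ∷ ps) z = prefixSum (take m z) ++ blockPrefixSum ps (drop m z)

affineMap-blockDiff : ∀ ps → IsAffineMap (blockDiff ps)
affineMap-blockDiff [] = affine-proj
affineMap-blockDiff ((m , _) ∷ ps) =
  affineMap-++ (affineMap-∘ affineMap-diff (affineMap-take m)) (affineMap-∘ (affineMap-blockDiff ps) (affineMap-drop m))

affineMap-blockPrefixSum : ∀ ps → IsAffineMap (blockPrefixSum ps)
affineMap-blockPrefixSum [] = affine-proj
affineMap-blockPrefixSum ((m , _) ∷ ps) =
  affineMap-++ (affineMap-∘ affineMap-prefixSum (affineMap-take m)) (affineMap-∘ (affineMap-blockPrefixSum ps) (affineMap-drop m))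

blockPrefixSum-blockDiff : ∀ ps (z : Point (dimL ps)) → blockPrefixSum ps (blockDiff ps z) ≈ₚ z
blockPrefixSum-blockDiff [] z j = refl
blockPrefixSum-blockDiff ((m , _) ∷ ps) z j = sym (≗-++ z _ _
  (λ i → sym (trans (affineMap-cong affineMap-prefixSum (lookup-++ˡ (diff (take m z)) (blockDiff ps (drop m z))) i)
                    (prefixSum-diff (take m z) i)))
  (λ i → sym (trans (affineMap-cong (affineMap-blockPrefixSum ps) (lookup-++ʳ (diff (take m z)) (blockDiff ps (drop m z))) i)
                    (blockPrefixSum-blockDiff ps (drop m z) i)))
  j)

evalPoint : ∀ {k} → Source k → Point k → ℚ
evalPoint (coord i) w = w i
evalPoint (const b) w = bit b
evalPoint previous w = 0ℚ

selectPoint : ∀ {m k} → (Fin m → Source k) → Point k → Point m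
selectPoint σ w j = evalPoint (σ j) w

affineMap-selectPoint : ∀ {m k} (σ : Fin m → Source k) → IsAffineMap (selectPoint σ)
affineMap-selectPoint σ j with σ j
... | coord i = affine-proj i
... | const b = affine-const (bit b)
... | previous = affine-const 0ℚ

bits-select : ∀ {m k} (σ : Fin m → Source k) (y : BitVec k) → bits (select σ y false) ≈ₚ selectPoint σ (bits y)
bits-select σ y j with σ j
... | coord i = refl
... | const b = refl
... | previous = refl

ProductVertex : (ps : ArcList) → Point (dimL ps) → Set
ProductVertex [] z = ⊤
ProductVertex ((m , β) ∷ ps) z = ShardVertex β (take m z) × ProductVertex ps (drop m z)

productVertex-resp : ∀ ps {x y} → x ≈ₚ y → ProductVertex ps x → ProductVertex ps y
productVertex-resp [] _ _ = tt
productVertex-resp ((m , β) ∷ ps) x≈y (vertex , rest) =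
  shardVertex-resp β (λ i → x≈y (i ↑ˡ _)) vertex , productVertex-resp ps (λ i → x≈y (m ↑ʳ i)) rest

InProd⇔hull : ∀ ps z → InProd ps z ⇔ ConvexHull (ProductVertex ps) z
InProd⇔hull [] z = mk⇔ (λ _ → singleton-hull tt) (λ _ → tt)
InProd⇔hull ((m , β) ∷ ps) z = mk⇔
  (λ (inSP , inProd) → hull-⊗⁺ (shardVertex-resp β) (productVertex-resp ps) z
                          (to (InSP⇔hull β _) inSP) (to (InProd⇔hull ps _) inProd))
  (λ hz → let (hull₁ , hull₂) = hull-⊗⁻ z hz in from (InSP⇔hull β _) hull₁ , from (InProd⇔hull ps _) hull₂)

feasibleProduct⇒vertex : ∀ ps (z : BitVec (dimL ps)) → FeasibleProduct ps z → ProductVertex ps (blockDiff ps (bits z))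
feasibleProduct⇒vertex [] z _ = tt
feasibleProduct⇒vertex ((m , β) ∷ ps) z (feasible , rest) =
  (take m z , feasible , lookup-++ˡ (diff (take m (bits z))) (blockDiff ps (drop m (bits z)))) ,
  productVertex-resp ps (λ i → sym (lookup-++ʳ (diff (take m (bits z))) (blockDiff ps (drop m (bits z))) i))
    (feasibleProduct⇒vertex ps (drop m z) rest)

vertex⇒feasibleProduct : ∀ ps (w : Point (dimL ps)) → ProductVertex ps w →
  Σ (BitVec (dimL ps)) λ z → FeasibleProduct ps z × w ≈ₚ blockDiff ps (bits z)
vertex⇒feasibleProduct [] w _ = (λ ()) , tt , λ ()
vertex⇒feasibleProduct ((m , β) ∷ ps) w ((y , feasible , w₁≈) , rest) =
  let (z' , rest' , w₂≈) = vertex⇒feasibleProduct ps (drop m w) rest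
      z = y ++ z'
  in z ,
     (feasible-resp β (λ i → sym (lookup-++ˡ y z' i)) feasible , feasibleProduct-resp ps (λ i → sym (lookup-++ʳ y z' i)) rest') ,
     ≗-++ w _ _
       (λ i → trans (w₁≈ i) (affineMap-cong affineMap-diff (λ i' → cong bit (sym (lookup-++ˡ y z' i'))) i))
       (λ i → trans (w₂≈ i) (affineMap-cong (affineMap-blockDiff ps) (λ i' → cong bit (sym (lookup-++ʳ y z' i'))) i))

module FaceDecomposition {n} (α : Arc n) (c : Point n) where
  open Optimum α c

  varies-unfixed : ∀ p → Varies p → unfixed (constraint p) ≡ true
  varies-unfixed p (w , Sw , wₚ≢) with constraint p | constraint-spec p
  ... | _ | fixed-spec fixedₚ = ⊥-elim (wₚ≢ (fixedₚ w Sw))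
  ... | _ | first-spec _ _ = refl
  ... | _ | afterFixed-spec _ _ _ _ = refl
  ... | _ | same-spec _ _ _ _ _ = refl
  ... | _ | step-spec _ _ _ _ _ = refl

  constraint-wellFormed : WellFormed false constraint
  constraint-wellFormed i with constraint i | constraint-spec i
  ... | _ | fixed-spec _ = tt
  ... | _ | first-spec _ _ = tt
  ... | _ | afterFixed-spec _ _ _ _ = tt
  ... | _ | same-spec _ p pred≡ variesₚ _ = trans (proj₂ (predecessor-just pred≡) false _) (varies-unfixed p variesₚ)
  ... | _ | step-spec _ p pred≡ variesₚ _ = trans (proj₂ (predecessor-just pred≡) false _) (varies-unfixed p variesₚ)

  layout : Layout n
  layout = layoutOf constraint

  optimal⇔inLayout : ∀ y → Optimal y ⇔ InLayout layout y
  optimal⇔inLayout y = ⇔.trans (mk⇔ (S⇒locallyValid y) (locallyValid⇒S y)) (⇔.sym (layoutOf-correct constraint constraint-wellFormed false y))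

  arcs : ArcList
  arcs = layoutArcs layout

  private
    I = layoutIso layout

  toProduct : Point n → Point (dimL arcs)
  toProduct x = blockDiff arcs (selectPoint (σ I) (prefixSum x))

  fromProduct : Point (dimL arcs) → Point n
  fromProduct w = diff (selectPoint (τ I) (blockPrefixSum arcs w))

  toProduct-affine : IsAffineMap toProduct
  toProduct-affine = affineMap-∘ (affineMap-blockDiff arcs) (affineMap-∘ (affineMap-selectPoint (σ I)) affineMap-prefixSum)

  fromProduct-affine : IsAffineMap fromProduct
  fromProduct-affine = affineMap-∘ affineMap-diff (affineMap-∘ (affineMap-selectPoint (τ I)) (affineMap-blockPrefixSum arcs))

  toProduct-δ : ∀ {v} y → v ≈ₚ δ y → toProduct v ≈ₚ blockDiff arcs (bits (select (σ I) y false))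
  toProduct-δ y v≈δy j = trans (affineMap-cong toProduct-affine v≈δy j) (affineMap-cong (affineMap-blockDiff arcs)
    (λ j → trans (affine-cong (affineMap-selectPoint (σ I) j) (prefixSum-diff (bits y))) (sym (bits-select (σ I) y j))) j)

  fromProduct-blockDiff : ∀ z → fromProduct (blockDiff arcs (bits z)) ≈ₚ δ (select (τ I) z false)
  fromProduct-blockDiff z = affineMap-cong affineMap-diff
    (λ j → trans (affine-cong (affineMap-selectPoint (τ I) j) (blockPrefixSum-blockDiff arcs (bits z))) (sym (bits-select (τ I) z j)))

  toProduct-maps : ∀ v → OptimalVertex v → ProductVertex arcs (toProduct v)
  toProduct-maps v (y , optimal , v≈δy) = productVertex-resp arcs (λ j → sym (toProduct-δ y v≈δy j))
    (feasibleProduct⇒vertex arcs _ (σ-maps I false y (to (optimal⇔inLayout y) optimal)))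

  fromProduct∘toProduct : ∀ v → OptimalVertex v → fromProduct (toProduct v) ≈ₚ v
  fromProduct∘toProduct v (y , optimal , v≈δy) i = begin
      fromProduct (toProduct v) i
    ≡⟨ affine-cong (fromProduct-affine i) (toProduct-δ y v≈δy) ⟩
      fromProduct (blockDiff arcs (bits (select (σ I) y false))) i
    ≡⟨ fromProduct-blockDiff (select (σ I) y false) i ⟩
      δ (select (τ I) (select (σ I) y false) false) i
    ≡⟨ affineMap-cong affineMap-diff (λ j → cong bit (τ∘σ I false y (to (optimal⇔inLayout y) optimal) j)) i ⟩
      δ y i
    ≡⟨ sym (v≈δy i) ⟩
      v i ∎
    where open ≡-Reasoning

  toProduct-onto : ∀ w → ProductVertex arcs w → Σ (Point n) λ v → OptimalVertex v × toProduct v ≈ₚ w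
  toProduct-onto w vertex =
    let (z , feasible , w≈) = vertex⇒feasibleProduct arcs w vertex
        y = select (τ I) z false
    in δ y , (y , from (optimal⇔inLayout y) (τ-maps I false z feasible) , λ _ → refl) ,
       λ j → trans (toProduct-δ y (λ _ → refl) j)
         (trans (affineMap-cong (affineMap-blockDiff arcs) (λ j' → cong bit (σ∘τ I false z feasible j')) j) (sym (w≈ j)))

  face≅product : AffinelyIsomorphic (InFace α c) (InProd arcs)
  face≅product = affinelyIsomorphic-resp (InFace⇔hull) (InProd⇔hull arcs)
    (hull-affinelyIsomorphic toProduct-affine fromProduct-affine toProduct-maps fromProduct∘toProduct toProduct-onto)

proposition45 : (n : ℕ) (α : Arc n) (c : Point n) →
    ∃ λ (ps : ArcList) → AffinelyIsomorphic (InFace α c) (InProd ps)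
proposition45 n α c = FaceDecomposition.arcs α c , FaceDecomposition.face≅product α c
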